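{- Let $\alpha$ be a weak composition and $m,n$ positive integers. Then $r_{m,n}$ is defined on $\alpha$ (i.e. $\mathsf{supp}(\alpha)\subseteq[n]$ and $\alpha_i\le m$ for all $i$) if and only if $r_{m,n}$ is defined on $\kappa_\alpha$ (i.e. $\kappa_\alpha\in\mathbb{Q}[x_1,\dots,x_n]$ and each variable has exponent at most $m$ in each monomial of $\kappa_\alpha$). In this case, $r_{m,n}(\kappa_\alpha)=\kappa_{r_{m,n}(\alpha)}$.
   Context: A weak composition is a sequence of non-negative integers with finitely many positive entries; $\mathsf{supp}(\alpha)=\{i:\alpha_i>0\}$; partition = weakly decreasing; $s_i\alpha$ swaps entries $i,i+1$. $r_{m,n}(\alpha)=(m-\alpha_n,\dots,m-\alpha_1)$, and for polynomials $r_{m,n}(f)=x_1^m\cdots x_n^mf(x_n^{ -1},\dots,x_1^{ -1})$. Let $\partial_i(f)=\frac{f-s_if}{x_i-x_{i+1}}$ ($s_i$ swapping $x_i,x_{i+1}$) and $\pi_i(f)=\partial_i(x_if)$. Key polynomials: $\kappa_\alpha=x^\alpha$ if $\alpha$ is a partition, and $\kappa_\alpha=\pi_i(\kappa_{s_i\alpha})$ if $\alpha_i<\alpha_{i+1}$. -}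

module Defs where

-- Conventions:
--  * A weak composition / exponent vector is a List ℕ; the entry at list
--    position k (0-based) is α_{k+1}; all positions past the end are 0.
--    Two lists differing only by trailing zeros denote the same sequence.
--  * Variables: X k denotes x_{k+1}.  swapE k / sPoly k realise s_{k+1}.
--  * Polynomials in ℚ[x_1,x_2,...] are finite formal sums of terms
--    (coefficient , exponent vector), compared by their coefficient functions.

open import Data.Nat using (ℕ; zero; suc; _≤_; _<_; _∸_; _+_; _≡ᵇ_)
open import Data.Bool using (Bool; true; false; _∧_; if_then_else_)
open import Data.List using (List; []; _∷_; _++_; map; replicate; reverse; upTo; concatMap)
open import Data.Product using (_×_; _,_)
open import Data.Rational using (ℚ; 0ℚ; 1ℚ) renaming (_+_ to _+ℚ_; _*_ to _*ℚ_; -_ to -ℚ_)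
open import Relation.Binary.PropositionalEquality using (_≡_)
open import Relation.Nullary using (¬_)

Exp : Set
Exp = List ℕ

at : Exp → ℕ → ℕ
at []      _       = 0
at (a ∷ _) zero    = a
at (_ ∷ t) (suc k) = at t k

IsPartition : Exp → Set
IsPartition α = ∀ k → at α (suc k) ≤ at α k

swapE : ℕ → Exp → Exp
swapE zero    []            = []
swapE zero    (a ∷ [])      = 0 ∷ a ∷ []
swapE zero    (a ∷ b ∷ t)   = b ∷ a ∷ t
swapE (suc k) []            = []
swapE (suc k) (a ∷ t)       = a ∷ swapE k t

addE : Exp → Exp → Exp
addE []       ys       = ys
addE (x ∷ xs) []       = x ∷ xs
addE (x ∷ xs) (y ∷ ys) = (x + y) ∷ addE xs ys

isZero : ℕ → Bool
isZero zero    = true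
isZero (suc _) = false

sameExp : Exp → Exp → Bool
sameExp []       []       = true
sameExp []       (y ∷ ys) = isZero y ∧ sameExp [] ys
sameExp (x ∷ xs) []       = isZero x ∧ sameExp xs []
sameExp (x ∷ xs) (y ∷ ys) = (x ≡ᵇ y) ∧ sameExp xs ys

-- r_{m,n}(α) = (m - α_n, ..., m - α_1)
rExp : ℕ → ℕ → Exp → Exp
rExp m n α = reverse (map (λ j → m ∸ at α j) (upTo n))

RDefComp : ℕ → ℕ → Exp → Set
RDefComp m n α = (∀ k → n ≤ k → at α k ≡ 0) × (∀ k → at α k ≤ m)

Poly : Set
Poly = List (ℚ × Exp)

coeff : Poly → Exp → ℚ
coeff []             β = 0ℚ
coeff ((c , γ) ∷ f)  β = if sameExp γ β then c +ℚ coeff f β else coeff f β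

infix 4 _≈ₚ_
_≈ₚ_ : Poly → Poly → Set
f ≈ₚ g = ∀ β → coeff f β ≡ coeff g β

mono : Exp → Poly
mono α = (1ℚ , α) ∷ []

X : ℕ → Poly
X k = mono (replicate k 0 ++ (1 ∷ []))

negP : Poly → Poly
negP = map (λ { (c , γ) → (-ℚ c , γ) })

_⊕_ : Poly → Poly → Poly
f ⊕ g = f ++ g

_⊖_ : Poly → Poly → Poly
f ⊖ g = f ++ negP g

_⊗_ : Poly → Poly → Poly
f ⊗ g = concatMap (λ { (c , γ) → map (λ { (d , δ) → (c *ℚ d , addE γ δ) }) g }) f

infixl 6 _⊕_ _⊖_
infixl 7 _⊗_

sPoly : ℕ → Poly → Poly
sPoly k = map (λ { (c , γ) → (c , swapE k γ) })

-- g = ∂_{k+1} f , i.e. (x_{k+1} - x_{k+2}) g = f - s_{k+1} f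
IsDivDiff : ℕ → Poly → Poly → Set
IsDivDiff k f g = (X k ⊖ X (suc k)) ⊗ g ≈ₚ f ⊖ sPoly k f

-- g = π_{k+1} f = ∂_{k+1}(x_{k+1} f)
IsPi : ℕ → Poly → Poly → Set
IsPi k f g = IsDivDiff k (X k ⊗ f) g

-- Key α f  :  f = κ_α  (recursive definition of key polynomials)
data Key : Exp → Poly → Set where
  key-part : ∀ {α f} → IsPartition α → f ≈ₚ mono α → Key α f
  key-step : ∀ {α f g} k → at α k < at α (suc k) →
             Key (swapE k α) g → IsPi k g f → Key α f

RDefPoly : ℕ → ℕ → Poly → Set
RDefPoly m n f = ∀ β → ¬ (coeff f β ≡ 0ℚ) → RDefComp m n β

-- r_{m,n}(f) = x_1^m⋯x_n^m f(x_n^{-1},…,x_1^{-1}); on a monomial x^β with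
-- supp β ⊆ [n], β ≤ m this is x^{r_{m,n}(β)} (only meaningful when defined)
rPoly : ℕ → ℕ → Poly → Poly
rPoly m n = map (λ { (c , β) → (c , rExp m n β) })

-- The explicit formula for π_{k+1}
-- shows that every monomial of π_{k+1}(g) arises from a monomial of g by moving exponent between positions
-- k+1 and k+2 inwards, keeping their sum. Moving inwards does not increase the sum of squared exponents,
-- and it stays in the box of exponent vectors supported in [n] with entries ≤ m. Hence κ_α has
-- coefficient 1 at x^α (the term of the formula at s_{k+1}α; all other terms are strictly more spread out)
-- and no monomial of larger sum of squares, and κ_α lives in the box when α does: this is the equivalence.
-- For the identity, r_{m,n} turns multiplication by x_i into division by x_{n+1−i}, which conjugates the
-- defining relation (x_i − x_{i+1}) π_i(g) = x_i g − s_i(x_i g) into the one for π_{n−i}; since r_{m,n} also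
-- maps partitions to partitions and s_i α to s_{n−i} r_{m,n}(α), induction gives r_{m,n}(κ_α) = κ_{r_{m,n}(α)}.
-- Monomials with an exponent m + 1 at the two positions involved need separate care, since r_{m,n} is
-- only defined inside the box.

module Submission where

open import Defs
open import Data.Nat using (ℕ; zero; suc; _+_; _*_; _∸_; _≤_; _<_; z≤n; s≤s)
open import Data.Nat.Properties
  using (_≟_; _≤?_; _<?_; ≡ᵇ⇒≡; ≡⇒≡ᵇ; suc-injective; 1+n≢0; 1+n≢n; +-identityʳ; +-suc; +-comm;
         +-assoc; m+n∸m≡n; m+n∸n≡m; n∸n≡0; m+[n∸m]≡n; m∸n+n≡m; +-∸-assoc; m≤m+n; m<m+n; m<n⇒0<n∸m;
         n≮0; ≤-refl; ≤-antisym; ≤-trans; <-≤-trans; <-trans; <⇒≤; ≰⇒>; ≮⇒≥; ≤-pred; <-irrefl; ≤-reflexive;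
         m∸n≤m; m∸[m∸n]≡n; ∸-monoʳ-≤; ∸-monoʳ-<; m≤n⇒m≤1+n; +-monoˡ-≤; +-monoʳ-≤; +-monoʳ-<;
         +-cancelˡ-≤; +-cancelʳ-≤; +-cancelʳ-<; +-cancelʳ-≡)
open import Data.Nat.Tactic.RingSolver using (solve-∀)
open import Data.Bool using (Bool; true; false; T; if_then_else_)
open import Data.Bool.Properties using (T-≡; T-∧)
open import Data.List using ([]; _∷_; _++_; map; replicate; reverse; upTo; downFrom; applyDownFrom; length)
open import Data.List.Properties using (reverse-map; reverse-upTo; map-downFrom)
open import Data.Product using (_×_; _,_; proj₁; proj₂; ∃)
open import Data.Sum using (_⊎_; inj₁; inj₂)
open import Data.Empty using (⊥-elim)
open import Data.Unit using (tt)
open import Data.Rational using (ℚ; 0ℚ; 1ℚ)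
  renaming (_+_ to _+ℚ_; _-_ to _-ℚ_; _*_ to _*ℚ_; -_ to -ℚ_)
import Data.Rational.Properties as ℚ
open import Data.Rational.Solver using (module +-*-Solver)
open import Function using (_∘_)
open import Function.Bundles using (_⇔_; mk⇔; Equivalence)
open import Relation.Binary.PropositionalEquality
  using (_≡_; _≢_; refl; sym; trans; cong; cong₂; subst; subst₂; ≢-sym; module ≡-Reasoning)
open import Relation.Nullary using (¬_; yes; no; Dec)

infix 4 _≐_
record _≐_ (a b : Exp) : Set where
  constructor pointwise
  field at-≡ : ∀ i → at a i ≡ at b i
open _≐_

≐-refl : ∀ {a} → a ≐ a
≐-refl = pointwise λ _ → refl

≐-sym : ∀ {a b} → a ≐ b → b ≐ a
≐-sym e = pointwise λ i → sym (at-≡ e i)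

≐-trans : ∀ {a b c} → a ≐ b → b ≐ c → a ≐ c
≐-trans e f = pointwise λ i → trans (at-≡ e i) (at-≡ f i)

at-[] : ∀ i → at [] i ≡ 0
at-[] zero    = refl
at-[] (suc i) = refl

≐-split : ∀ {a b} k → at a k ≡ at b k → (∀ p → p ≢ k → at a p ≡ at b p) → a ≐ b
≐-split {a} {b} k eq-k eq-other = pointwise go
  where
  go : ∀ p → at a p ≡ at b p
  go p with p ≟ k
  ... | yes refl = eq-k
  ... | no p≢k   = eq-other p p≢k

≐-split₂ : ∀ {a b} k → at a k ≡ at b k → at a (suc k) ≡ at b (suc k) →
           (∀ p → p ≢ k → p ≢ suc k → at a p ≡ at b p) → a ≐ b
≐-split₂ {a} {b} k eq-k eq-sk eq-other = ≐-split k eq-k go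
  where
  go : ∀ p → p ≢ k → at a p ≡ at b p
  go p p≢k with p ≟ suc k
  ... | yes refl  = eq-sk
  ... | no p≢sk   = eq-other p p≢k p≢sk

T-sameExp⇒≐ : ∀ a b → T (sameExp a b) → ∀ i → at a i ≡ at b i
T-sameExp⇒≐ []           []           _ i       = refl
T-sameExp⇒≐ []           (zero ∷ ys)  t zero    = refl
T-sameExp⇒≐ []           (zero ∷ ys)  t (suc i) = T-sameExp⇒≐ [] ys t i
T-sameExp⇒≐ (zero ∷ xs)  []           t zero    = refl
T-sameExp⇒≐ (zero ∷ xs)  []           t (suc i) = T-sameExp⇒≐ xs [] t i
T-sameExp⇒≐ (x ∷ xs)     (y ∷ ys)     t zero    = ≡ᵇ⇒≡ x y (proj₁ (Equivalence.to T-∧ t))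
T-sameExp⇒≐ (x ∷ xs)     (y ∷ ys)     t (suc i) = T-sameExp⇒≐ xs ys (proj₂ (Equivalence.to T-∧ t)) i

≐⇒T-sameExp : ∀ a b → (∀ i → at a i ≡ at b i) → T (sameExp a b)
≐⇒T-sameExp []       []       e = tt
≐⇒T-sameExp []       (y ∷ ys) e rewrite sym (e 0) = ≐⇒T-sameExp [] ys (e ∘ suc)
≐⇒T-sameExp (x ∷ xs) []       e rewrite e 0 = ≐⇒T-sameExp xs [] (e ∘ suc)
≐⇒T-sameExp (x ∷ xs) (y ∷ ys) e =
  Equivalence.from T-∧ (≡⇒≡ᵇ x y (e 0) , ≐⇒T-sameExp xs ys (e ∘ suc))

sameExp⇒≐ : ∀ a b → sameExp a b ≡ true → a ≐ b
sameExp⇒≐ a b e = pointwise (T-sameExp⇒≐ a b (Equivalence.from T-≡ e))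

≐⇒sameExp : ∀ a b → a ≐ b → sameExp a b ≡ true
≐⇒sameExp a b e = Equivalence.to T-≡ (≐⇒T-sameExp a b (at-≡ e))

sameExp-cong : ∀ a b c d → (a ≐ b → c ≐ d) → (c ≐ d → a ≐ b) → sameExp a b ≡ sameExp c d
sameExp-cong a b c d to from with sameExp a b in eab | sameExp c d in ecd
... | true  | true  = refl
... | false | false = refl
... | true  | false = trans (sym (≐⇒sameExp c d (to (sameExp⇒≐ a b eab)))) ecd
... | false | true  = sym (trans (sym (≐⇒sameExp a b (from (sameExp⇒≐ c d ecd)))) eab)

sameExp-congʳ : ∀ γ {a b} → a ≐ b → sameExp γ a ≡ sameExp γ b
sameExp-congʳ γ {a} {b} e = sameExp-cong γ a γ b (λ x → ≐-trans x e) (λ x → ≐-trans x (≐-sym e))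

coeff-cong : ∀ f {a b} → a ≐ b → coeff f a ≡ coeff f b
coeff-cong []            e = refl
coeff-cong ((c , γ) ∷ f) {a} {b} e
  rewrite sameExp-congʳ γ e | coeff-cong f e = refl

update : ℕ → ℕ → Exp → Exp
update zero    v []      = v ∷ []
update zero    v (_ ∷ t) = v ∷ t
update (suc k) v []      = 0 ∷ update k v []
update (suc k) v (a ∷ t) = a ∷ update k v t

at-update-≡ : ∀ k v β → at (update k v β) k ≡ v
at-update-≡ zero    v []      = refl
at-update-≡ zero    v (_ ∷ β) = refl
at-update-≡ (suc k) v []      = at-update-≡ k v []
at-update-≡ (suc k) v (_ ∷ β) = at-update-≡ k v β

at-update-≢ : ∀ k v β p → p ≢ k → at (update k v β) p ≡ at β p
at-update-≢ zero    v []      zero    p≢k = ⊥-elim (p≢k refl)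
at-update-≢ zero    v []      (suc p) p≢k = at-[] p
at-update-≢ zero    v (_ ∷ β) zero    p≢k = ⊥-elim (p≢k refl)
at-update-≢ zero    v (_ ∷ β) (suc p) p≢k = refl
at-update-≢ (suc k) v []      zero    p≢k = refl
at-update-≢ (suc k) v []      (suc p) p≢k = at-update-≢ k v [] p (p≢k ∘ cong suc)
at-update-≢ (suc k) v (_ ∷ β) zero    p≢k = refl
at-update-≢ (suc k) v (_ ∷ β) (suc p) p≢k = at-update-≢ k v β p (p≢k ∘ cong suc)

update-update : ∀ k v w β → update k v (update k w β) ≐ update k v β
update-update k v w β = ≐-split k
  (trans (at-update-≡ k v _) (sym (at-update-≡ k v β)))
  (λ p p≢k → trans (at-update-≢ k v _ p p≢k)
               (trans (at-update-≢ k w β p p≢k) (sym (at-update-≢ k v β p p≢k))))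

update₂ : ℕ → ℕ → ℕ → Exp → Exp
update₂ k i j β = update k i (update (suc k) j β)

at-update₂-k : ∀ k i j β → at (update₂ k i j β) k ≡ i
at-update₂-k k i j β = at-update-≡ k i _

at-update₂-suc : ∀ k i j β → at (update₂ k i j β) (suc k) ≡ j
at-update₂-suc k i j β = trans (at-update-≢ k i _ (suc k) 1+n≢n) (at-update-≡ (suc k) j β)

at-update₂-≢ : ∀ k i j β p → p ≢ k → p ≢ suc k → at (update₂ k i j β) p ≡ at β p
at-update₂-≢ k i j β p p≢k p≢sk = trans (at-update-≢ k i _ p p≢k) (at-update-≢ (suc k) j β p p≢sk)

update₂-self : ∀ k i j β → at β k ≡ i → at β (suc k) ≡ j → update₂ k i j β ≐ β
update₂-self k i j β refl refl =
  ≐-split₂ k (at-update₂-k k i j β) (at-update₂-suc k i j β) (at-update₂-≢ k i j β)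

unit : ℕ → Exp
unit k = replicate k 0 ++ (1 ∷ [])

at-unit-≡ : ∀ k → at (unit k) k ≡ 1
at-unit-≡ zero    = refl
at-unit-≡ (suc k) = at-unit-≡ k

at-unit-≢ : ∀ k p → p ≢ k → at (unit k) p ≡ 0
at-unit-≢ zero    zero    p≢k = ⊥-elim (p≢k refl)
at-unit-≢ zero    (suc p) p≢k = at-[] p
at-unit-≢ (suc k) zero    p≢k = refl
at-unit-≢ (suc k) (suc p) p≢k = at-unit-≢ k p (p≢k ∘ cong suc)

at-addE : ∀ a b p → at (addE a b) p ≡ at a p + at b p
at-addE []      b       p       rewrite at-[] p = refl
at-addE (x ∷ a) []      zero    = sym (+-identityʳ x)
at-addE (x ∷ a) []      (suc p) rewrite at-[] p = sym (+-identityʳ (at a p))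
at-addE (x ∷ a) (y ∷ b) zero    = refl
at-addE (x ∷ a) (y ∷ b) (suc p) = at-addE a b p

at-swapE-k : ∀ k β → at (swapE k β) k ≡ at β (suc k)
at-swapE-k zero    []          = refl
at-swapE-k zero    (_ ∷ [])    = refl
at-swapE-k zero    (_ ∷ _ ∷ β) = refl
at-swapE-k (suc k) []          = refl
at-swapE-k (suc k) (_ ∷ β)     = at-swapE-k k β

at-swapE-suc : ∀ k β → at (swapE k β) (suc k) ≡ at β k
at-swapE-suc zero    []          = refl
at-swapE-suc zero    (_ ∷ [])    = refl
at-swapE-suc zero    (_ ∷ _ ∷ β) = refl
at-swapE-suc (suc k) []          = refl
at-swapE-suc (suc k) (_ ∷ β)     = at-swapE-suc k β

at-swapE-≢ : ∀ k β p → p ≢ k → p ≢ suc k → at (swapE k β) p ≡ at β p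
at-swapE-≢ zero    []          p             _   _    = refl
at-swapE-≢ zero    (_ ∷ [])    zero          p≢k _    = ⊥-elim (p≢k refl)
at-swapE-≢ zero    (_ ∷ [])    (suc zero)    _   p≢sk = ⊥-elim (p≢sk refl)
at-swapE-≢ zero    (_ ∷ [])    (suc (suc p)) _   _    = at-[] p
at-swapE-≢ zero    (_ ∷ _ ∷ β) zero          p≢k _    = ⊥-elim (p≢k refl)
at-swapE-≢ zero    (_ ∷ _ ∷ β) (suc zero)    _   p≢sk = ⊥-elim (p≢sk refl)
at-swapE-≢ zero    (_ ∷ _ ∷ β) (suc (suc p)) _   _    = refl
at-swapE-≢ (suc k) []          p             _   _    = refl
at-swapE-≢ (suc k) (_ ∷ β)     zero          _   _    = refl
at-swapE-≢ (suc k) (_ ∷ β)     (suc p)       p≢k p≢sk =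
  at-swapE-≢ k β p (p≢k ∘ cong suc) (p≢sk ∘ cong suc)

swapE-cong : ∀ k {β γ} → β ≐ γ → swapE k β ≐ swapE k γ
swapE-cong k {β} {γ} e = ≐-split₂ k
  (trans (at-swapE-k k β) (trans (at-≡ e (suc k)) (sym (at-swapE-k k γ))))
  (trans (at-swapE-suc k β) (trans (at-≡ e k) (sym (at-swapE-suc k γ))))
  (λ p p≢k p≢sk → trans (at-swapE-≢ k β p p≢k p≢sk)
                   (trans (at-≡ e p) (sym (at-swapE-≢ k γ p p≢k p≢sk))))

swapE-involutive : ∀ k β → swapE k (swapE k β) ≐ β
swapE-involutive k β = ≐-split₂ k
  (trans (at-swapE-k k _) (at-swapE-suc k β))
  (trans (at-swapE-suc k _) (at-swapE-k k β))
  (λ p p≢k p≢sk → trans (at-swapE-≢ k _ p p≢k p≢sk) (at-swapE-≢ k β p p≢k p≢sk))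

coeff-++ : ∀ f g β → coeff (f ++ g) β ≡ coeff f β +ℚ coeff g β
coeff-++ []            g β = sym (ℚ.+-identityˡ _)
coeff-++ ((c , γ) ∷ f) g β with sameExp γ β
... | true  rewrite coeff-++ f g β = sym (ℚ.+-assoc c _ _)
... | false = coeff-++ f g β

coeff-negP : ∀ f β → coeff (negP f) β ≡ -ℚ coeff f β
coeff-negP []            β = refl
coeff-negP ((c , γ) ∷ f) β with sameExp γ β
... | true  rewrite coeff-negP f β = sym (ℚ.neg-distrib-+ c _)
... | false = coeff-negP f β

coeff-sPoly : ∀ k f β → coeff (sPoly k f) β ≡ coeff f (swapE k β)
coeff-sPoly k []            β = refl
coeff-sPoly k ((c , γ) ∷ f) β
  rewrite sameExp-cong (swapE k γ) β γ (swapE k β)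
            (λ e → ≐-trans (≐-sym (swapE-involutive k γ)) (swapE-cong k e))
            (λ e → ≐-trans (swapE-cong k e) (swapE-involutive k β))
        | coeff-sPoly k f β = refl

-- The coefficient function of x_{k+1} · h, in terms of the coefficient function H of h.
mulX : ℕ → (Exp → ℚ) → Exp → ℚ
mulX k H β with at β k
... | zero  = 0ℚ
... | suc a = H (update k a β)

mulX-zero : ∀ k H β → at β k ≡ 0 → mulX k H β ≡ 0ℚ
mulX-zero k H β e with at β k
mulX-zero k H β refl | .zero = refl

mulX-suc : ∀ k H β a → at β k ≡ suc a → mulX k H β ≡ H (update k a β)
mulX-suc k H β a e with at β k
mulX-suc k H β a refl | .(suc a) = refl

sameExp-unit-addE : ∀ k δ β a → at β k ≡ suc a →
                    sameExp (addE (unit k) δ) β ≡ sameExp δ (update k a β)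
sameExp-unit-addE k δ β a eq = sameExp-cong _ _ _ _ to from
  where
  at-sum : ∀ p → at (addE (unit k) δ) p ≡ at (unit k) p + at δ p
  at-sum = at-addE (unit k) δ
  to : addE (unit k) δ ≐ β → δ ≐ update k a β
  to e = ≐-split k
    (suc-injective (begin
      suc (at δ k)               ≡⟨ cong (_+ at δ k) (sym (at-unit-≡ k)) ⟩
      at (unit k) k + at δ k     ≡⟨ sym (at-sum k) ⟩
      at (addE (unit k) δ) k     ≡⟨ at-≡ e k ⟩
      at β k                     ≡⟨ eq ⟩
      suc a                      ≡⟨ cong suc (sym (at-update-≡ k a β)) ⟩
      suc (at (update k a β) k)  ∎))
    (λ p p≢k → begin
      at δ p                     ≡⟨ cong (_+ at δ p) (sym (at-unit-≢ k p p≢k)) ⟩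
      at (unit k) p + at δ p     ≡⟨ sym (at-sum p) ⟩
      at (addE (unit k) δ) p     ≡⟨ at-≡ e p ⟩
      at β p                     ≡⟨ sym (at-update-≢ k a β p p≢k) ⟩
      at (update k a β) p        ∎)
    where open ≡-Reasoning
  from : δ ≐ update k a β → addE (unit k) δ ≐ β
  from e = ≐-split k
    (trans (at-sum k) (trans (cong₂ _+_ (at-unit-≡ k) (at-≡ e k))
                       (trans (cong suc (at-update-≡ k a β)) (sym eq))))
    (λ p p≢k → trans (at-sum p) (trans (cong₂ _+_ (at-unit-≢ k p p≢k) (at-≡ e p))
                                  (at-update-≢ k a β p p≢k)))

sameExp-unit-addE-zero : ∀ k δ β → at β k ≡ 0 → sameExp (addE (unit k) δ) β ≡ false
sameExp-unit-addE-zero k δ β eq with sameExp (addE (unit k) δ) β in e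
... | false = refl
... | true  = ⊥-elim (1+n≢0 (begin
  suc (at δ k)               ≡⟨ cong (_+ at δ k) (sym (at-unit-≡ k)) ⟩
  at (unit k) k + at δ k     ≡⟨ sym (at-addE (unit k) δ k) ⟩
  at (addE (unit k) δ) k     ≡⟨ at-≡ (sameExp⇒≐ (addE (unit k) δ) β e) k ⟩
  at β k                     ≡⟨ eq ⟩
  0                          ∎))
  where open ≡-Reasoning

coeff-monomial⊗ : ∀ c k h β → coeff (((c , unit k) ∷ []) ⊗ h) β ≡ c *ℚ mulX k (coeff h) β
coeff-monomial⊗ c k [] β with at β k
... | zero  = sym (ℚ.*-zeroʳ c)
... | suc _ = sym (ℚ.*-zeroʳ c)
coeff-monomial⊗ c k ((d , δ) ∷ h) β with at β k in eq | coeff-monomial⊗ c k h β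
... | zero  | ih rewrite sameExp-unit-addE-zero k δ β eq = ih
... | suc a | ih rewrite sameExp-unit-addE k δ β a eq with sameExp δ (update k a β)
...   | true  = trans (cong (c *ℚ d +ℚ_) ih) (sym (ℚ.*-distribˡ-+ c d _))
...   | false = ih

coeff-∷⊗ : ∀ t f h β → coeff ((t ∷ f) ⊗ h) β ≡ coeff ((t ∷ []) ⊗ h) β +ℚ coeff (f ⊗ h) β
coeff-∷⊗ (c , γ) f h β =
  trans (coeff-++ row (f ⊗ h) β)
        (cong (_+ℚ coeff (f ⊗ h) β) (sym (trans (coeff-++ row [] β) (ℚ.+-identityʳ (coeff row β)))))
  where row = map (λ t → (c *ℚ proj₁ t , addE γ (proj₂ t))) h

coeff-X⊗ : ∀ k h β → coeff (X k ⊗ h) β ≡ mulX k (coeff h) β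
coeff-X⊗ k h β = trans (coeff-monomial⊗ 1ℚ k h β) (ℚ.*-identityˡ _)

PiCoeffs : ℕ → Poly → Poly → Set
PiCoeffs k g f = ∀ β → mulX k (coeff f) β -ℚ mulX (suc k) (coeff f) β
                     ≡ mulX k (coeff g) β -ℚ mulX k (coeff g) (swapE k β)

coeff-divDiffLhs : ∀ k f β → coeff ((X k ⊖ X (suc k)) ⊗ f) β
                             ≡ mulX k (coeff f) β -ℚ mulX (suc k) (coeff f) β
coeff-divDiffLhs k f β = begin
  coeff ((X k ⊖ X (suc k)) ⊗ f) β
    ≡⟨ coeff-∷⊗ (1ℚ , unit k) ((-ℚ 1ℚ , unit (suc k)) ∷ []) f β ⟩
  coeff (((1ℚ , unit k) ∷ []) ⊗ f) β +ℚ coeff (((-ℚ 1ℚ , unit (suc k)) ∷ []) ⊗ f) β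
    ≡⟨ cong₂ _+ℚ_ (coeff-X⊗ k f β)
                  (trans (coeff-∷⊗ (-ℚ 1ℚ , unit (suc k)) [] f β) (ℚ.+-identityʳ _)) ⟩
  mulX k (coeff f) β +ℚ coeff (((-ℚ 1ℚ , unit (suc k)) ∷ []) ⊗ f) β
    ≡⟨ cong (mulX k (coeff f) β +ℚ_) (coeff-monomial⊗ (-ℚ 1ℚ) (suc k) f β) ⟩
  mulX k (coeff f) β +ℚ (-ℚ 1ℚ) *ℚ mulX (suc k) (coeff f) β
    ≡⟨ cong (mulX k (coeff f) β +ℚ_) (sym (ℚ.neg-distribˡ-* 1ℚ (mulX (suc k) (coeff f) β))) ⟩
  mulX k (coeff f) β +ℚ -ℚ (1ℚ *ℚ mulX (suc k) (coeff f) β)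
    ≡⟨ cong (λ x → mulX k (coeff f) β -ℚ x) (ℚ.*-identityˡ (mulX (suc k) (coeff f) β)) ⟩
  mulX k (coeff f) β -ℚ mulX (suc k) (coeff f) β ∎
  where open ≡-Reasoning

coeff-divDiffRhs : ∀ k g β → coeff (X k ⊗ g ⊖ sPoly k (X k ⊗ g)) β
                             ≡ mulX k (coeff g) β -ℚ mulX k (coeff g) (swapE k β)
coeff-divDiffRhs k g β = begin
  coeff (X k ⊗ g ⊖ sPoly k (X k ⊗ g)) β
    ≡⟨ coeff-++ (X k ⊗ g) (negP (sPoly k (X k ⊗ g))) β ⟩
  coeff (X k ⊗ g) β +ℚ coeff (negP (sPoly k (X k ⊗ g))) β
    ≡⟨ cong (coeff (X k ⊗ g) β +ℚ_) (coeff-negP (sPoly k (X k ⊗ g)) β) ⟩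
  coeff (X k ⊗ g) β -ℚ coeff (sPoly k (X k ⊗ g)) β
    ≡⟨ cong₂ _-ℚ_ (coeff-X⊗ k g β) (trans (coeff-sPoly k (X k ⊗ g) β) (coeff-X⊗ k g (swapE k β))) ⟩
  mulX k (coeff g) β -ℚ mulX k (coeff g) (swapE k β) ∎
  where open ≡-Reasoning

IsPi⇔PiCoeffs : ∀ k g f → IsPi k g f ⇔ PiCoeffs k g f
IsPi⇔PiCoeffs k g f = mk⇔
  (λ pi β → trans (sym (coeff-divDiffLhs k f β)) (trans (pi β) (coeff-divDiffRhs k g β)))
  (λ pc β → trans (coeff-divDiffLhs k f β) (trans (pc β) (sym (coeff-divDiffRhs k g β))))

-- The explicit formula for π

∑ : ℕ → (ℕ → ℚ) → ℚ
∑ zero    h = 0ℚ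
∑ (suc n) h = h 0 +ℚ ∑ n (h ∘ suc)

∑-last : ∀ n h → ∑ (suc n) h ≡ ∑ n h +ℚ h n
∑-last zero    h = trans (ℚ.+-identityʳ (h 0)) (sym (ℚ.+-identityˡ (h 0)))
∑-last (suc n) h rewrite ∑-last n (h ∘ suc) = sym (ℚ.+-assoc (h 0) _ _)

∑-split : ∀ a b h → ∑ (a + b) h ≡ ∑ a h +ℚ ∑ b (λ j → h (a + j))
∑-split zero    b h = sym (ℚ.+-identityˡ _)
∑-split (suc a) b h rewrite ∑-split a b (h ∘ suc) = sym (ℚ.+-assoc (h 0) _ _)

∑-cong : ∀ n {h h′} → (∀ j → j < n → h j ≡ h′ j) → ∑ n h ≡ ∑ n h′
∑-cong zero    e = refl
∑-cong (suc n) e = cong₂ _+ℚ_ (e 0 (s≤s z≤n)) (∑-cong n (λ j j<n → e (suc j) (s≤s j<n)))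

∑-zero : ∀ n h → (∀ j → j < n → h j ≡ 0ℚ) → ∑ n h ≡ 0ℚ
∑-zero n h e = trans (∑-cong n e) (∑-const-zero n)
  where
  ∑-const-zero : ∀ n → ∑ n (λ _ → 0ℚ) ≡ 0ℚ
  ∑-const-zero zero    = refl
  ∑-const-zero (suc n) = trans (ℚ.+-identityˡ _) (∑-const-zero n)

∑-nonzero : ∀ n h → ∑ n h ≢ 0ℚ → ∃ λ j → j < n × h j ≢ 0ℚ
∑-nonzero zero    h ne = ⊥-elim (ne refl)
∑-nonzero (suc n) h ne with h 0 ℚ.≟ 0ℚ
... | no h0≢0  = 0 , s≤s z≤n , h0≢0
... | yes h0≡0 with ∑-nonzero n (h ∘ suc) (λ z → ne (trans (cong₂ _+ℚ_ h0≡0 z) refl))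
...   | j , j<n , hj≢0 = suc j , s≤s j<n , hj≢0

sub-nonzero : ∀ x y → x -ℚ y ≢ 0ℚ → x ≢ 0ℚ ⊎ y ≢ 0ℚ
sub-nonzero x y ne with x ℚ.≟ 0ℚ | y ℚ.≟ 0ℚ
... | no x≢0    | _        = inj₁ x≢0
... | yes _     | no y≢0   = inj₂ y≢0
... | yes refl  | yes refl = ⊥-elim (ne refl)

antidiagonal : (ℕ → ℕ → ℚ) → ℕ → ℕ → ℚ
antidiagonal G N i = G i (N ∸ i)

-- Σ_{j ≤ B} G(A+j, B−j) − Σ_{j < B} G(j, A+B−j): the coefficient of π_{k+1}(g) at an exponent
-- with entries A, B at positions k, k+1, where G i j is the coefficient of g after replacing them by i, j.
πSum : (ℕ → ℕ → ℚ) → ℕ → ℕ → ℚ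
πSum G A B = ∑ (suc B) (λ j → antidiagonal G (A + B) (A + j)) -ℚ ∑ B (antidiagonal G (A + B))

πSum-sym : ∀ G A B → πSum G A B ≡ ∑ (suc A) (λ j → antidiagonal G (A + B) (B + j))
                                    -ℚ ∑ A (antidiagonal G (A + B))
πSum-sym G A B = rearrange (∑ (suc B) (λ j → h (A + j))) (∑ B h) (∑ (suc A) (λ j → h (B + j))) (∑ A h)
  (begin
    ∑ A h +ℚ ∑ (suc B) (λ j → h (A + j)) ≡⟨ sym (∑-split A (suc B) h) ⟩
    ∑ (A + suc B) h                      ≡⟨ cong (λ n → ∑ n h) (+-suc-comm A B) ⟩
    ∑ (B + suc A) h                      ≡⟨ ∑-split B (suc A) h ⟩
    ∑ B h +ℚ ∑ (suc A) (λ j → h (B + j)) ∎)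
  where
  open ≡-Reasoning
  open +-*-Solver
  h = antidiagonal G (A + B)
  +-suc-comm : ∀ A B → A + suc B ≡ B + suc A
  +-suc-comm A B = trans (+-suc A B) (trans (cong suc (+-comm A B)) (sym (+-suc B A)))
  rearrange : ∀ x v u y → y +ℚ x ≡ v +ℚ u → x -ℚ v ≡ u -ℚ y
  rearrange x v u y e = begin
    x -ℚ v                   ≡⟨ solve 3 (λ x v y → x :- v := (y :+ x) :- (y :+ v)) refl x v y ⟩
    (y +ℚ x) -ℚ (y +ℚ v)     ≡⟨ cong (_-ℚ (y +ℚ v)) e ⟩
    (v +ℚ u) -ℚ (y +ℚ v)     ≡⟨ solve 3 (λ u y v → (v :+ u) :- (y :+ v) := u :- y) refl u y v ⟩
    u -ℚ y                   ∎

telescope : ∀ (F G : ℕ → ℕ → ℚ) →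
            (∀ A → F A 0 ≡ G A 0) →
            (∀ A B → F A (suc B) -ℚ F (suc A) B ≡ G A (suc B) -ℚ G B (suc A)) →
            ∀ A B → F A B ≡ πSum G A B
telescope F G base step A zero = begin
  F A 0                             ≡⟨ base A ⟩
  G A 0                             ≡⟨ cong (G A) (sym (n∸n≡0 A)) ⟩
  antidiagonal G A A                ≡⟨ sym (ℚ.+-identityʳ _) ⟩
  antidiagonal G A A +ℚ 0ℚ          ≡⟨ sym (ℚ.+-identityʳ _) ⟩
  (antidiagonal G A A +ℚ 0ℚ) -ℚ 0ℚ  ≡⟨ cong (λ a → (antidiagonal G a a +ℚ 0ℚ) -ℚ 0ℚ) (sym (+-identityʳ A)) ⟩
  πSum G A 0                        ∎
  where open ≡-Reasoning
telescope F G base step A (suc B) = begin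
  F A (suc B)
    ≡⟨ solve 2 (λ a b → a := (a :- b) :+ b) refl (F A (suc B)) (F (suc A) B) ⟩
  (F A (suc B) -ℚ F (suc A) B) +ℚ F (suc A) B
    ≡⟨ cong₂ _+ℚ_ (step A B) (telescope F G base step (suc A) B) ⟩
  (G A (suc B) -ℚ G B (suc A)) +ℚ (∑ (suc B) (λ j → h (suc A + j)) -ℚ ∑ B h)
    ≡⟨ solve 4 (λ a b x y → (a :- b) :+ (x :- y) := (a :+ x) :- (y :+ b)) refl
               (G A (suc B)) (G B (suc A)) (∑ (suc B) (λ j → h (suc A + j))) (∑ B h) ⟩
  (G A (suc B) +ℚ ∑ (suc B) (λ j → h (suc A + j))) -ℚ (∑ B h +ℚ G B (suc A))
    ≡⟨ cong₂ (λ x y → (x +ℚ ∑ (suc B) (λ j → h (suc A + j))) -ℚ (∑ B h +ℚ y)) first last ⟩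
  (h (A + 0) +ℚ ∑ (suc B) (λ j → h (suc A + j))) -ℚ (∑ B h +ℚ h B)
    ≡⟨ cong₂ (λ x y → (h (A + 0) +ℚ x) -ℚ y) (∑-cong (suc B) (λ j _ → cong h (sym (+-suc A j)))) (sym (∑-last B h)) ⟩
  (h (A + 0) +ℚ ∑ (suc B) (λ j → h (A + suc j))) -ℚ ∑ (suc B) h
    ≡⟨ cong πSum′ (sym (+-suc A B)) ⟩
  πSum G A (suc B) ∎
  where
  open ≡-Reasoning
  open +-*-Solver
  h = antidiagonal G (suc (A + B))
  πSum′ : ℕ → ℚ
  πSum′ n = ∑ (suc (suc B)) (λ j → antidiagonal G n (A + j)) -ℚ ∑ (suc B) (antidiagonal G n)
  first : G A (suc B) ≡ h (A + 0)
  first = sym (trans (cong h (+-identityʳ A))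
                     (cong (G A) (trans (cong (_∸ A) (sym (+-suc A B))) (m+n∸m≡n A (suc B)))))
  last : G B (suc A) ≡ h B
  last = sym (cong (G B) (m+n∸n≡m (suc A) B))

≐-update₂ : ∀ k i j β γ → at γ k ≡ i → at γ (suc k) ≡ j →
            (∀ p → p ≢ k → p ≢ suc k → at γ p ≡ at β p) → γ ≐ update₂ k i j β
≐-update₂ k i j β γ eq-k eq-sk eq-other = ≐-split₂ k
  (trans eq-k (sym (at-update₂-k k i j β)))
  (trans eq-sk (sym (at-update₂-suc k i j β)))
  (λ p p≢k p≢sk → trans (eq-other p p≢k p≢sk) (sym (at-update₂-≢ k i j β p p≢k p≢sk)))

mulX-update₂-k : ∀ k h A B β → mulX k (coeff h) (update₂ k (suc A) B β) ≡ coeff h (update₂ k A B β)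
mulX-update₂-k k h A B β =
  trans (mulX-suc k (coeff h) (update₂ k (suc A) B β) A (at-update₂-k k (suc A) B β))
        (coeff-cong h (update-update k A (suc A) (update (suc k) B β)))

mulX-update₂-suc : ∀ k h A B β → mulX (suc k) (coeff h) (update₂ k A (suc B) β) ≡ coeff h (update₂ k A B β)
mulX-update₂-suc k h A B β =
  trans (mulX-suc (suc k) (coeff h) p B (at-update₂-suc k A (suc B) β))
        (coeff-cong h (≐-update₂ k A B β (update (suc k) B p)
          (trans (at-update-≢ (suc k) B p k (≢-sym 1+n≢n)) (at-update₂-k k A (suc B) β))
          (at-update-≡ (suc k) B p)
          (λ q q≢k q≢sk → trans (at-update-≢ (suc k) B p q q≢sk) (at-update₂-≢ k A (suc B) β q q≢k q≢sk))))
  where p = update₂ k A (suc B) β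

mulX-swapE-update₂ : ∀ k h A B β → mulX k (coeff h) (swapE k (update₂ k A (suc B) β)) ≡ coeff h (update₂ k B A β)
mulX-swapE-update₂ k h A B β =
  trans (mulX-suc k (coeff h) (swapE k p) B (trans (at-swapE-k k p) (at-update₂-suc k A (suc B) β)))
        (coeff-cong h (≐-update₂ k B A β (update k B (swapE k p))
          (at-update-≡ k B (swapE k p))
          (trans (at-update-≢ k B (swapE k p) (suc k) 1+n≢n) (trans (at-swapE-suc k p) (at-update₂-k k A (suc B) β)))
          (λ q q≢k q≢sk → trans (at-update-≢ k B (swapE k p) q q≢k)
                           (trans (at-swapE-≢ k p q q≢k q≢sk) (at-update₂-≢ k A (suc B) β q q≢k q≢sk)))))
  where p = update₂ k A (suc B) β

coeff-π : ∀ k g f → PiCoeffs k g f →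
          ∀ β → coeff f β ≡ πSum (λ i j → coeff g (update₂ k i j β)) (at β k) (at β (suc k))
coeff-π k g f pc β = trans (sym (coeff-cong f (update₂-self k _ _ β refl refl))) (telescope F G base step _ _)
  where
  F G : ℕ → ℕ → ℚ
  F i j = coeff f (update₂ k i j β)
  G i j = coeff g (update₂ k i j β)
  minus-zero : ∀ x → x -ℚ 0ℚ ≡ x
  minus-zero = ℚ.+-identityʳ
  base : ∀ A → F A 0 ≡ G A 0
  base A = begin
    F A 0
      ≡⟨ sym (trans (cong₂ _-ℚ_ (mulX-update₂-k k f A 0 β) (mulX-zero (suc k) (coeff f) p (at-update₂-suc k (suc A) 0 β)))
                    (minus-zero (F A 0))) ⟩
    mulX k (coeff f) p -ℚ mulX (suc k) (coeff f) p
      ≡⟨ pc p ⟩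
    mulX k (coeff g) p -ℚ mulX k (coeff g) (swapE k p)
      ≡⟨ trans (cong₂ _-ℚ_ (mulX-update₂-k k g A 0 β)
                           (mulX-zero k (coeff g) (swapE k p) (trans (at-swapE-k k p) (at-update₂-suc k (suc A) 0 β))))
               (minus-zero (G A 0)) ⟩
    G A 0 ∎
    where
    open ≡-Reasoning
    p = update₂ k (suc A) 0 β
  step : ∀ A B → F A (suc B) -ℚ F (suc A) B ≡ G A (suc B) -ℚ G B (suc A)
  step A B = begin
    F A (suc B) -ℚ F (suc A) B
      ≡⟨ sym (cong₂ _-ℚ_ (mulX-update₂-k k f A (suc B) β) (mulX-update₂-suc k f (suc A) B β)) ⟩
    mulX k (coeff f) p -ℚ mulX (suc k) (coeff f) p
      ≡⟨ pc p ⟩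
    mulX k (coeff g) p -ℚ mulX k (coeff g) (swapE k p)
      ≡⟨ cong₂ _-ℚ_ (mulX-update₂-k k g A (suc B) β) (mulX-swapE-update₂ k g (suc A) B β) ⟩
    G A (suc B) -ℚ G B (suc A) ∎
    where
    open ≡-Reasoning
    p = update₂ k (suc A) (suc B) β

-- Spreading two entries apart with constant sum increases the sum of squares

private
  shifted-by : ∀ x y p q → x + y ≡ p + q → x ≤ p → y ≤ p →
               ∃ λ a → ∃ λ b → x ≡ q + b × y ≡ q + a × p ≡ q + a + b
  shifted-by x y p q e x≤p y≤p = y ∸ q , x ∸ q , x≡ , y≡ , p≡
    where
    q≤x : q ≤ x
    q≤x = +-cancelˡ-≤ p q x (subst (_≤ p + x) e (subst (x + y ≤_) (+-comm x p) (+-monoʳ-≤ x y≤p)))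
    q≤y : q ≤ y
    q≤y = +-cancelˡ-≤ p q y (subst (_≤ p + y) e (+-monoˡ-≤ y x≤p))
    x≡ : x ≡ q + (x ∸ q)
    x≡ = sym (m+[n∸m]≡n q≤x)
    y≡ : y ≡ q + (y ∸ q)
    y≡ = sym (m+[n∸m]≡n q≤y)
    sum-identity : ∀ q a b → (q + b) + (q + a) ≡ (q + a + b) + q
    sum-identity = solve-∀
    p≡ : p ≡ q + (y ∸ q) + (x ∸ q)
    p≡ = +-cancelʳ-≡ q p _ (trans (sym e) (trans (cong₂ _+_ x≡ y≡) (sum-identity q (y ∸ q) (x ∸ q))))

  square-identity : ∀ q a b → (q + b) * (q + b) + (q + a) * (q + a) + 2 * (a * b)
                            ≡ (q + a + b) * (q + a + b) + q * q
  square-identity = solve-∀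

spread-≤ : ∀ x y p q → x + y ≡ p + q → x ≤ p → y ≤ p → x * x + y * y ≤ p * p + q * q
spread-≤ x y p q e x≤p y≤p with shifted-by x y p q e x≤p y≤p
... | a , b , refl , refl , refl =
  subst ((q + b) * (q + b) + (q + a) * (q + a) ≤_) (square-identity q a b) (m≤m+n _ (2 * (a * b)))

spread-< : ∀ x y p q → x + y ≡ p + q → x < p → y < p → x * x + y * y < p * p + q * q
spread-< x y p q e x<p y<p with shifted-by x y p q e (<⇒≤ x<p) (<⇒≤ y<p)
... | zero  , b     , refl , refl , refl = ⊥-elim (<-irrefl refl (subst (q + b <_) (cong (_+ b) (+-identityʳ q)) x<p))
... | suc a , zero  , refl , refl , refl = ⊥-elim (<-irrefl refl (subst (q + suc a <_) (+-identityʳ _) y<p))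
... | suc a , suc b , refl , refl , refl =
  subst ((q + suc b) * (q + suc b) + (q + suc a) * (q + suc a) <_) (square-identity q (suc a) (suc b))
        (m<m+n _ {2 * (suc a * suc b)} (s≤s z≤n))

-- The pair (i, A + B − i) is more spread out than (A, B).
Spread : ℕ → ℕ → ℕ → Set
Spread A B i = (A ≤ i × B ≤ i) ⊎ (i < A × i < B)

m≤m+n∸o : ∀ A B i → i ≤ B → A ≤ A + B ∸ i
m≤m+n∸o A B i i≤B = subst (A ≤_) (sym (+-∸-assoc A i≤B)) (m≤m+n A (B ∸ i))

m<m+n∸o : ∀ A B i → i < B → A < A + B ∸ i
m<m+n∸o A B i i<B = subst (A <_) (sym (+-∸-assoc A (<⇒≤ i<B))) (m<m+n A (m<n⇒0<n∸m i<B))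

spread-bounded : ∀ {A B i m} → Spread A B i → i ≤ m → A + B ∸ i ≤ m → A ≤ m × B ≤ m
spread-bounded {A} {B} {i} (inj₁ (A≤i , B≤i)) i≤m _ = ≤-trans A≤i i≤m , ≤-trans B≤i i≤m
spread-bounded {A} {B} {i} (inj₂ (i<A , i<B)) _ j≤m =
  ≤-trans (m≤m+n∸o A B i (<⇒≤ i<B)) j≤m ,
  ≤-trans (subst (λ n → B ≤ n ∸ i) (+-comm B A) (m≤m+n∸o B A i (<⇒≤ i<A))) j≤m

spread-squares-< : ∀ A B i → i ≤ A + B → (A < i × B < i) ⊎ (i < A × i < B) →
                   A * A + B * B < i * i + (A + B ∸ i) * (A + B ∸ i)
spread-squares-< A B i i≤N (inj₁ (A<i , B<i)) = spread-< A B i (A + B ∸ i) (sym (m+[n∸m]≡n i≤N)) A<i B<i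
spread-squares-< A B i i≤N (inj₂ (i<A , i<B)) =
  subst (A * A + B * B <_) (+-comm ((A + B ∸ i) * (A + B ∸ i)) (i * i))
    (spread-< A B (A + B ∸ i) i (sym (m∸n+n≡m i≤N))
      (m<m+n∸o A B i i<B)
      (subst (λ n → B < n ∸ i) (+-comm B A) (m<m+n∸o B A i i<A)))

spread-squares : ∀ A B i → i ≤ A + B → Spread A B i →
                 A * A + B * B ≤ i * i + (A + B ∸ i) * (A + B ∸ i)
spread-squares A B i i≤N (inj₁ (A≤i , B≤i)) = spread-≤ A B i (A + B ∸ i) (sym (m+[n∸m]≡n i≤N)) A≤i B≤i
spread-squares A B i i≤N (inj₂ (i<A , i<B)) =
  subst (A * A + B * B ≤_) (+-comm ((A + B ∸ i) * (A + B ∸ i)) (i * i))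
    (spread-≤ A B (A + B ∸ i) i (sym (m∸n+n≡m i≤N))
      (m≤m+n∸o A B i (<⇒≤ i<B))
      (subst (λ n → B ≤ n ∸ i) (+-comm B A) (m≤m+n∸o B A i (<⇒≤ i<A))))

πSum-nonzero : ∀ G A B → πSum G A B ≢ 0ℚ →
               ∃ λ i → i ≤ A + B × Spread A B i × antidiagonal G (A + B) i ≢ 0ℚ
πSum-nonzero G A B ne with B ≤? A
... | yes B≤A = from-sums (sub-nonzero _ _ ne)
  where
  h = antidiagonal G (A + B)
  from-sums : ∑ (suc B) (λ j → h (A + j)) ≢ 0ℚ ⊎ ∑ B h ≢ 0ℚ →
              ∃ λ i → i ≤ A + B × Spread A B i × h i ≢ 0ℚ
  from-sums (inj₁ nz) with ∑-nonzero (suc B) (λ j → h (A + j)) nz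
  ... | j , j<sB , hj≢0 =
    A + j , +-monoʳ-≤ A (≤-pred j<sB) , inj₁ (m≤m+n A j , ≤-trans B≤A (m≤m+n A j)) , hj≢0
  from-sums (inj₂ nz) with ∑-nonzero B h nz
  ... | j , j<B , hj≢0 =
    j , ≤-trans (<⇒≤ j<B) (subst (B ≤_) (+-comm B A) (m≤m+n B A)) , inj₂ (<-≤-trans j<B B≤A , j<B) , hj≢0
... | no B≰A = from-sums (sub-nonzero _ _ (ne ∘ trans (πSum-sym G A B)))
  where
  A<B = ≰⇒> B≰A
  h = antidiagonal G (A + B)
  from-sums : ∑ (suc A) (λ j → h (B + j)) ≢ 0ℚ ⊎ ∑ A h ≢ 0ℚ →
              ∃ λ i → i ≤ A + B × Spread A B i × h i ≢ 0ℚ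
  from-sums (inj₁ nz) with ∑-nonzero (suc A) (λ j → h (B + j)) nz
  ... | j , j<sA , hj≢0 =
    B + j , subst (B + j ≤_) (+-comm B A) (+-monoʳ-≤ B (≤-pred j<sA)) ,
    inj₁ (≤-trans (<⇒≤ A<B) (m≤m+n B j) , m≤m+n B j) , hj≢0
  from-sums (inj₂ nz) with ∑-nonzero A h nz
  ... | j , j<A , hj≢0 = j , ≤-trans (<⇒≤ j<A) (m≤m+n A B) , inj₂ (j<A , <-trans j<A A<B) , hj≢0

coeff-π-nonzero : ∀ k g f → PiCoeffs k g f → ∀ β → coeff f β ≢ 0ℚ →
                  let A = at β k; B = at β (suc k) in
                  ∃ λ i → i ≤ A + B × Spread A B i × coeff g (update₂ k i (A + B ∸ i) β) ≢ 0ℚ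
coeff-π-nonzero k g f pc β ne =
  πSum-nonzero (λ i j → coeff g (update₂ k i j β)) _ _ (ne ∘ trans (coeff-π k g f pc β))

-- Key polynomials are unitriangular with respect to the sum of squares of exponents

normSq : Exp → ℕ
normSq []       = 0
normSq (x ∷ xs) = x * x + normSq xs

normSq-cong : ∀ {a b} → a ≐ b → normSq a ≡ normSq b
normSq-cong {a} {b} e = go a b (at-≡ e)
  where
  go : ∀ a b → (∀ i → at a i ≡ at b i) → normSq a ≡ normSq b
  go []       []       e = refl
  go []       (y ∷ ys) e rewrite sym (e 0) = go [] ys (e ∘ suc)
  go (x ∷ xs) []       e rewrite e 0 = go xs [] (e ∘ suc)
  go (x ∷ xs) (y ∷ ys) e rewrite e 0 = cong (y * y +_) (go xs ys (e ∘ suc))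

normSq-swapE : ∀ k β → normSq (swapE k β) ≡ normSq β
normSq-swapE zero    []          = refl
normSq-swapE zero    (a ∷ [])    = refl
normSq-swapE zero    (a ∷ b ∷ β) = exchange a b (normSq β)
  where
  exchange : ∀ a b s → b * b + (a * a + s) ≡ a * a + (b * b + s)
  exchange = solve-∀
normSq-swapE (suc k) []          = refl
normSq-swapE (suc k) (a ∷ β)     = cong (a * a +_) (normSq-swapE k β)

normSq-update : ∀ k v β → normSq (update k v β) + at β k * at β k ≡ normSq β + v * v
normSq-update zero    v []      = trans (+-identityʳ (v * v + 0)) (+-identityʳ (v * v))
normSq-update zero    v (x ∷ β) = exchange v (normSq β) x
  where
  exchange : ∀ v s x → (v * v + s) + x * x ≡ (x * x + s) + v * v
  exchange = solve-∀
normSq-update (suc k) v []      = normSq-update k v []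
normSq-update (suc k) v (x ∷ β) = begin
  (x * x + normSq (update k v β)) + at β k * at β k ≡⟨ +-assoc (x * x) _ _ ⟩
  x * x + (normSq (update k v β) + at β k * at β k) ≡⟨ cong (x * x +_) (normSq-update k v β) ⟩
  x * x + (normSq β + v * v)                        ≡⟨ sym (+-assoc (x * x) (normSq β) (v * v)) ⟩
  (x * x + normSq β) + v * v                        ∎
  where open ≡-Reasoning

normSq-update₂ : ∀ k i j β →
  normSq (update₂ k i j β) + (at β k * at β k + at β (suc k) * at β (suc k)) ≡ normSq β + (i * i + j * j)
normSq-update₂ k i j β = begin
  normSq γ + (a * a + b * b)          ≡⟨ sym (+-assoc (normSq γ) (a * a) (b * b)) ⟩
  (normSq γ + a * a) + b * b          ≡⟨ cong (λ x → (normSq γ + x * x) + b * b) a≡a′ ⟩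
  (normSq γ + a′ * a′) + b * b        ≡⟨ cong (_+ b * b) (normSq-update k i β′) ⟩
  (normSq β′ + i * i) + b * b         ≡⟨ +-assoc (normSq β′) (i * i) (b * b) ⟩
  normSq β′ + (i * i + b * b)         ≡⟨ cong (normSq β′ +_) (+-comm (i * i) (b * b)) ⟩
  normSq β′ + (b * b + i * i)         ≡⟨ sym (+-assoc (normSq β′) (b * b) (i * i)) ⟩
  (normSq β′ + b * b) + i * i         ≡⟨ cong (_+ i * i) (normSq-update (suc k) j β) ⟩
  (normSq β + j * j) + i * i          ≡⟨ +-assoc (normSq β) (j * j) (i * i) ⟩
  normSq β + (j * j + i * i)          ≡⟨ cong (normSq β +_) (+-comm (j * j) (i * i)) ⟩
  normSq β + (i * i + j * j)          ∎
  where
  open ≡-Reasoning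
  β′ = update (suc k) j β
  γ = update₂ k i j β
  a = at β k
  a′ = at β′ k
  a≡a′ : a ≡ a′
  a≡a′ = sym (at-update-≢ (suc k) j β k (≢-sym 1+n≢n))
  b = at β (suc k)

normSq-update₂-≤ : ∀ k i j β → at β k * at β k + at β (suc k) * at β (suc k) ≤ i * i + j * j →
                   normSq β ≤ normSq (update₂ k i j β)
normSq-update₂-≤ k i j β le =
  +-cancelʳ-≤ (i * i + j * j) _ _
    (subst (_≤ normSq (update₂ k i j β) + (i * i + j * j)) (normSq-update₂ k i j β)
      (+-monoʳ-≤ (normSq (update₂ k i j β)) le))

normSq-update₂-< : ∀ k i j β → at β k * at β k + at β (suc k) * at β (suc k) < i * i + j * j →
                   normSq β < normSq (update₂ k i j β)
normSq-update₂-< k i j β lt =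
  +-cancelʳ-< (i * i + j * j) _ _
    (subst (_< normSq (update₂ k i j β) + (i * i + j * j)) (normSq-update₂ k i j β)
      (+-monoʳ-< (normSq (update₂ k i j β)) lt))

NormBounded : Poly → ℕ → Set
NormBounded f b = ∀ β → coeff f β ≢ 0ℚ → normSq β ≤ b

coeff-vanishes-above : ∀ {g b} → NormBounded g b → ∀ γ → b < normSq γ → coeff g γ ≡ 0ℚ
coeff-vanishes-above {g} bd γ b<γ with coeff g γ ℚ.≟ 0ℚ
... | yes z  = z
... | no nz = ⊥-elim (<-irrefl refl (<-≤-trans b<γ (bd γ nz)))

π-NormBounded : ∀ k g f b → PiCoeffs k g f → NormBounded g b → NormBounded f b
π-NormBounded k g f b pc bd β ne with coeff-π-nonzero k g f pc β ne
... | i , i≤N , spread , nz = ≤-trans (normSq-update₂-≤ k i _ β (spread-squares _ _ i i≤N spread)) (bd _ nz)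

π-leading : ∀ k g f α → at α k < at α (suc k) → PiCoeffs k g f →
            coeff g (swapE k α) ≡ 1ℚ → NormBounded g (normSq α) → coeff f α ≡ 1ℚ
π-leading k g f α A<B pc g-lead bd = begin
  coeff f α                                                     ≡⟨ coeff-π k g f pc α ⟩
  πSum G A B                                                    ≡⟨ πSum-sym G A B ⟩
  (h (B + 0) +ℚ ∑ A (λ j → h (B + suc j))) -ℚ ∑ A h             ≡⟨ cong₂ (λ x y → (h (B + 0) +ℚ x) -ℚ y) upper lower ⟩
  (h (B + 0) +ℚ 0ℚ) -ℚ 0ℚ                                       ≡⟨ trans (ℚ.+-identityʳ _) (ℚ.+-identityʳ _) ⟩
  h (B + 0)                                                     ≡⟨ coeff-cong g (≐-sym swapped) ⟩
  coeff g (swapE k α)                                           ≡⟨ g-lead ⟩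
  1ℚ                                                            ∎
  where
  open ≡-Reasoning
  A = at α k
  B = at α (suc k)
  G = λ i j → coeff g (update₂ k i j α)
  h = antidiagonal G (A + B)
  swapped : swapE k α ≐ update₂ k (B + 0) (A + B ∸ (B + 0)) α
  swapped = ≐-update₂ k _ _ α (swapE k α)
    (trans (at-swapE-k k α) (sym (+-identityʳ B)))
    (trans (at-swapE-suc k α) (sym (trans (cong (A + B ∸_) (+-identityʳ B)) (m+n∸n≡m A B))))
    (at-swapE-≢ k α)
  vanish : ∀ i → i ≤ A + B → (A < i × B < i) ⊎ (i < A × i < B) → h i ≡ 0ℚ
  vanish i i≤N spread =
    coeff-vanishes-above {g} bd _ (normSq-update₂-< k i (A + B ∸ i) α (spread-squares-< A B i i≤N spread))
  upper : ∑ A (λ j → h (B + suc j)) ≡ 0ℚ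
  upper = ∑-zero A _ λ j j<A →
    vanish (B + suc j) (subst (B + suc j ≤_) (+-comm B A) (+-monoʳ-≤ B j<A))
      (inj₁ (<-trans A<B (m<m+n B (s≤s z≤n)) , m<m+n B (s≤s z≤n)))
  lower : ∑ A h ≡ 0ℚ
  lower = ∑-zero A h λ j j<A →
    vanish j (≤-trans (<⇒≤ j<A) (m≤m+n A B)) (inj₂ (j<A , <-trans j<A A<B))

HasLeadingTerm : Exp → Poly → Set
HasLeadingTerm α f = coeff f α ≡ 1ℚ × NormBounded f (normSq α)

coeff-mono-nonzero : ∀ α β → coeff (mono α) β ≢ 0ℚ → α ≐ β
coeff-mono-nonzero α β ne with sameExp α β in e
... | true  = sameExp⇒≐ α β e
... | false = ⊥-elim (ne refl)

coeff-mono-self : ∀ α → coeff (mono α) α ≡ 1ℚ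
coeff-mono-self α rewrite ≐⇒sameExp α α ≐-refl = ℚ.+-identityʳ 1ℚ

coeff-mono-cong : ∀ {α α′} → α ≐ α′ → ∀ β → coeff (mono α) β ≡ coeff (mono α′) β
coeff-mono-cong {α} {α′} e β =
  cong (λ b → if b then 1ℚ +ℚ 0ℚ else 0ℚ) (sameExp-cong α β α′ β (≐-trans (≐-sym e)) (≐-trans e))

key-leading : ∀ {α f} → Key α f → HasLeadingTerm α f
key-leading (key-part {α} {f} _ f≈) =
  trans (f≈ α) (coeff-mono-self α) ,
  λ β ne → ≤-reflexive (normSq-cong (≐-sym (coeff-mono-nonzero α β (ne ∘ trans (f≈ β)))))
key-leading (key-step {α} {f} {g} k A<B key-g pi) =
  π-leading k g f α A<B pc g-lead bd , π-NormBounded k g f (normSq α) pc bd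
  where
  pc = Equivalence.to (IsPi⇔PiCoeffs k g f) pi
  g-lead = proj₁ (key-leading key-g)
  bd = subst (NormBounded g) (normSq-swapE k α) (proj₂ (key-leading key-g))

box-cong : ∀ {m n a b} → a ≐ b → RDefComp m n a → RDefComp m n b
box-cong {m} e (supp , bound) =
  (λ q n≤q → trans (sym (at-≡ e q)) (supp q n≤q)) , (λ q → subst (_≤ m) (at-≡ e q) (bound q))

≥-≢ : ∀ {k n q} → k < n → n ≤ q → q ≢ k
≥-≢ k<n n≤q refl = <-irrefl refl (<-≤-trans k<n n≤q)

box-by-cases₂ : ∀ {m n k} β γ → suc k < n → at β k ≤ m → at β (suc k) ≤ m →
                (∀ p → p ≢ k → p ≢ suc k → at β p ≡ at γ p) → RDefComp m n γ → RDefComp m n β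
box-by-cases₂ {m} {n} {k} β γ sk<n βk≤m βsk≤m agree (supp , bound) = supp′ , bound′
  where
  supp′ : ∀ q → n ≤ q → at β q ≡ 0
  supp′ q n≤q = trans (agree q (≥-≢ (<⇒≤ sk<n) n≤q) (≥-≢ sk<n n≤q)) (supp q n≤q)
  bound′ : ∀ q → at β q ≤ m
  bound′ q with q ≟ k | q ≟ suc k
  ... | yes refl | _        = βk≤m
  ... | no _     | yes refl = βsk≤m
  ... | no q≢k   | no q≢sk  = subst (_≤ m) (sym (agree q q≢k q≢sk)) (bound q)

swapE-box : ∀ {m n} k α → suc k < n → RDefComp m n α → RDefComp m n (swapE k α)
swapE-box {m} k α sk<n box@(_ , bound) =
  box-by-cases₂ (swapE k α) α sk<n (subst (_≤ m) (sym (at-swapE-k k α)) (bound (suc k)))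
                                   (subst (_≤ m) (sym (at-swapE-suc k α)) (bound k))
                                   (at-swapE-≢ k α) box

box-ascent : ∀ {m n} k α → RDefComp m n α → at α k < at α (suc k) → suc k < n
box-ascent k α (supp , _) A<B = ≰⇒> λ n≤sk → n≮0 (subst (at α k <_) (supp (suc k) n≤sk) A<B)

π-box : ∀ {m n} k g f → suc k < n → PiCoeffs k g f → RDefPoly m n g → RDefPoly m n f
π-box {m} k g f sk<n pc g-box β ne with coeff-π-nonzero k g f pc β ne
... | i , _ , spread , nz =
  box-by-cases₂ β γ sk<n A≤m B≤m (λ p p≢k p≢sk → sym (at-update₂-≢ k i _ β p p≢k p≢sk)) γ-box
  where
  γ = update₂ k i (at β k + at β (suc k) ∸ i) β
  γ-box = g-box γ nz
  bounds = spread-bounded spread (subst (_≤ m) (at-update₂-k k i _ β) (proj₂ γ-box k))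
                                 (subst (_≤ m) (at-update₂-suc k i _ β) (proj₂ γ-box (suc k)))
  A≤m = proj₁ bounds
  B≤m = proj₂ bounds

key-box : ∀ {m n α f} → RDefComp m n α → Key α f → RDefPoly m n f
key-box α-box (key-part {α} _ f≈) β ne =
  box-cong (coeff-mono-nonzero α β (ne ∘ trans (f≈ β))) α-box
key-box α-box (key-step {α} {f} {g} k A<B key-g pi) =
  π-box k g f sk<n (Equivalence.to (IsPi⇔PiCoeffs k g f) pi) (key-box (swapE-box k α sk<n α-box) key-g)
  where sk<n = box-ascent k α α-box A<B

box-of-key : ∀ {m n α f} → Key α f → RDefPoly m n f → RDefComp m n α
box-of-key {α = α} key-f f-box = f-box α (λ e → ℚ.1≢0 (trans (sym (proj₁ (key-leading key-f))) e))

mirror : ℕ → ℕ → ℕ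
mirror n p = n ∸ suc p

suc-mirror : ∀ n p → p < n → suc (mirror n p) ≡ n ∸ p
suc-mirror n p p<n = sym (+-∸-assoc 1 p<n)

mirror-< : ∀ n p → p < n → mirror n p < n
mirror-< (suc n) p _ = s≤s (m∸n≤m n p)

mirror-involutive : ∀ n p → p < n → mirror n (mirror n p) ≡ p
mirror-involutive n p p<n = trans (cong (n ∸_) (suc-mirror n p p<n)) (m∸[m∸n]≡n (<⇒≤ p<n))

mirror-injective : ∀ n p q → p < n → q < n → mirror n p ≡ mirror n q → p ≡ q
mirror-injective n p q p<n q<n e =
  trans (sym (mirror-involutive n p p<n)) (trans (cong (mirror n) e) (mirror-involutive n q q<n))

rExp-applyDownFrom : ∀ m n α → rExp m n α ≡ applyDownFrom (λ j → m ∸ at α j) n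
rExp-applyDownFrom m n α = begin
  reverse (map h (upTo n))  ≡⟨ sym (reverse-map h (upTo n)) ⟩
  map h (reverse (upTo n))  ≡⟨ cong (map h) (reverse-upTo n) ⟩
  map h (downFrom n)        ≡⟨ map-downFrom h n ⟩
  applyDownFrom h n         ∎
  where
  open ≡-Reasoning
  h = λ j → m ∸ at α j

at-applyDownFrom-< : ∀ h n q → q < n → at (applyDownFrom h n) q ≡ h (mirror n q)
at-applyDownFrom-< h (suc n) zero    _         = refl
at-applyDownFrom-< h (suc n) (suc q) (s≤s q<n) = at-applyDownFrom-< h n q q<n

at-applyDownFrom-≥ : ∀ h n q → n ≤ q → at (applyDownFrom h n) q ≡ 0
at-applyDownFrom-≥ h zero    q       _         = at-[] q
at-applyDownFrom-≥ h (suc n) (suc q) (s≤s n≤q) = at-applyDownFrom-≥ h n q n≤q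

at-rExp-< : ∀ m n α q → q < n → at (rExp m n α) q ≡ m ∸ at α (mirror n q)
at-rExp-< m n α q q<n rewrite rExp-applyDownFrom m n α = at-applyDownFrom-< _ n q q<n

at-rExp-≥ : ∀ m n α q → n ≤ q → at (rExp m n α) q ≡ 0
at-rExp-≥ m n α q n≤q rewrite rExp-applyDownFrom m n α = at-applyDownFrom-≥ _ n q n≤q

≐-inside : ∀ {n a b} → (∀ q → q < n → at a q ≡ at b q) → (∀ q → n ≤ q → at a q ≡ at b q) → a ≐ b
≐-inside {n} {a} {b} inside outside = pointwise go
  where
  go : ∀ q → at a q ≡ at b q
  go q with q <? n
  ... | yes q<n = inside q q<n
  ... | no q≮n  = outside q (≮⇒≥ q≮n)

rExp-cong : ∀ m n {β γ} → β ≐ γ → rExp m n β ≐ rExp m n γ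
rExp-cong m n {β} {γ} e = ≐-inside
  (λ q q<n → trans (at-rExp-< m n β q q<n) (trans (cong (m ∸_) (at-≡ e (mirror n q))) (sym (at-rExp-< m n γ q q<n))))
  (λ q n≤q → trans (at-rExp-≥ m n β q n≤q) (sym (at-rExp-≥ m n γ q n≤q)))

rExp-box : ∀ m n β → RDefComp m n (rExp m n β)
rExp-box m n β = at-rExp-≥ m n β , bound
  where
  bound : ∀ q → at (rExp m n β) q ≤ m
  bound q with q <? n
  ... | yes q<n = subst (_≤ m) (sym (at-rExp-< m n β q q<n)) (m∸n≤m m (at β (mirror n q)))
  ... | no q≮n  = subst (_≤ m) (sym (at-rExp-≥ m n β q (≮⇒≥ q≮n))) z≤n

rExp-involutive : ∀ m n β → RDefComp m n β → rExp m n (rExp m n β) ≐ β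
rExp-involutive m n β (supp , bound) = ≐-inside
  (λ q q<n → begin
     at (rExp m n (rExp m n β)) q   ≡⟨ at-rExp-< m n (rExp m n β) q q<n ⟩
     m ∸ at (rExp m n β) (mirror n q) ≡⟨ cong (m ∸_) (at-rExp-< m n β _ (mirror-< n q q<n)) ⟩
     m ∸ (m ∸ at β (mirror n (mirror n q))) ≡⟨ cong (λ p → m ∸ (m ∸ at β p)) (mirror-involutive n q q<n) ⟩
     m ∸ (m ∸ at β q)               ≡⟨ m∸[m∸n]≡n (bound q) ⟩
     at β q                         ∎)
  (λ q n≤q → trans (at-rExp-≥ m n (rExp m n β) q n≤q) (sym (supp q n≤q)))
  where open ≡-Reasoning

sameExp-rExp : ∀ m n β δ → RDefComp m n β → RDefComp m n δ →
               sameExp (rExp m n β) δ ≡ sameExp β (rExp m n δ)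
sameExp-rExp m n β δ β-box δ-box = sameExp-cong _ _ _ _
  (λ e → ≐-trans (≐-sym (rExp-involutive m n β β-box)) (rExp-cong m n e))
  (λ e → ≐-trans (rExp-cong m n e) (rExp-involutive m n δ δ-box))

box? : ∀ m n δ → Dec (RDefComp m n δ)
box? m n δ with sameExp (rExp m n (rExp m n δ)) δ in e
... | true  = yes (box-cong {m} {n} (sameExp⇒≐ (rExp m n (rExp m n δ)) δ e) (rExp-box m n (rExp m n δ)))
... | false = no λ δ-box → true≢false (trans (sym (≐⇒sameExp (rExp m n (rExp m n δ)) δ (rExp-involutive m n δ δ-box))) e)
  where
  true≢false : true ≢ false
  true≢false ()

coeffWhere : Poly → (Exp → Bool) → ℚ
coeffWhere []            χ = 0ℚ
coeffWhere ((c , γ) ∷ h) χ = if χ γ then c +ℚ coeffWhere h χ else coeffWhere h χ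

coeff-coeffWhere : ∀ h γ → coeff h γ ≡ coeffWhere h (λ β → sameExp β γ)
coeff-coeffWhere []            γ = refl
coeff-coeffWhere ((c , β) ∷ h) γ rewrite coeff-coeffWhere h γ = refl

coeff-rPoly-coeffWhere : ∀ m n h δ → coeff (rPoly m n h) δ ≡ coeffWhere h (λ β → sameExp (rExp m n β) δ)
coeff-rPoly-coeffWhere m n []            δ = refl
coeff-rPoly-coeffWhere m n ((c , β) ∷ h) δ rewrite coeff-rPoly-coeffWhere m n h δ = refl

Respects≐ : (Exp → Bool) → Set
Respects≐ χ = ∀ a b → a ≐ b → χ a ≡ χ b

dropExp : Exp → Poly → Poly
dropExp γ []            = []
dropExp γ ((c , β) ∷ h) = if sameExp β γ then dropExp γ h else (c , β) ∷ dropExp γ h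

length-dropExp : ∀ γ h → length (dropExp γ h) ≤ length h
length-dropExp γ []            = z≤n
length-dropExp γ ((c , β) ∷ h) with sameExp β γ
... | true  = m≤n⇒m≤1+n (length-dropExp γ h)
... | false = s≤s (length-dropExp γ h)

coeff-dropExp-≐ : ∀ γ h β → γ ≐ β → coeff (dropExp γ h) β ≡ 0ℚ
coeff-dropExp-≐ γ []            β e = refl
coeff-dropExp-≐ γ ((c , δ) ∷ h) β e with sameExp δ γ in δγ
... | true  = coeff-dropExp-≐ γ h β e
... | false rewrite sameExp-congʳ δ (≐-sym e) | δγ = coeff-dropExp-≐ γ h β e

coeff-dropExp-≢ : ∀ γ h β → ¬ γ ≐ β → coeff (dropExp γ h) β ≡ coeff h β
coeff-dropExp-≢ γ []            β ne = refl
coeff-dropExp-≢ γ ((c , δ) ∷ h) β ne with sameExp δ γ in δγ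
... | true with sameExp δ β in δβ
...   | true  = ⊥-elim (ne (≐-trans (≐-sym (sameExp⇒≐ δ γ δγ)) (sameExp⇒≐ δ β δβ)))
...   | false = coeff-dropExp-≢ γ h β ne
coeff-dropExp-≢ γ ((c , δ) ∷ h) β ne | false with sameExp δ β
...   | true  = cong (c +ℚ_) (coeff-dropExp-≢ γ h β ne)
...   | false = coeff-dropExp-≢ γ h β ne

coeffWhere-dropExp : ∀ χ → Respects≐ χ → ∀ γ h →
                     coeffWhere h χ ≡ (if χ γ then coeff h γ else 0ℚ) +ℚ coeffWhere (dropExp γ h) χ
coeffWhere-dropExp χ resp γ [] with χ γ
... | true  = sym (ℚ.+-identityˡ 0ℚ)
... | false = sym (ℚ.+-identityˡ 0ℚ)
coeffWhere-dropExp χ resp γ ((c , β) ∷ h) with sameExp β γ in βγ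
... | true rewrite resp β γ (sameExp⇒≐ β γ βγ) =
  add-head (χ γ) (coeffWhere-dropExp χ resp γ h)
  where
  add-head : ∀ b {X R Y} → Y ≡ (if b then X else 0ℚ) +ℚ R →
             (if b then c +ℚ Y else Y) ≡ (if b then c +ℚ X else 0ℚ) +ℚ R
  add-head true  e = trans (cong (c +ℚ_) e) (sym (ℚ.+-assoc c _ _))
  add-head false e = e
... | false = add-term (χ γ) (χ β) (coeffWhere-dropExp χ resp γ h)
  where
  open +-*-Solver
  add-term : ∀ b b′ {X R Y} → Y ≡ (if b then X else 0ℚ) +ℚ R →
             (if b′ then c +ℚ Y else Y) ≡ (if b then X else 0ℚ) +ℚ (if b′ then c +ℚ R else R)
  add-term b true  {X} {R} e =
    trans (cong (c +ℚ_) e) (solve 3 (λ c x r → c :+ (x :+ r) := x :+ (c :+ r)) refl c (if b then X else 0ℚ) R)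
  add-term b false e = e

-- Terms with equal exponents must be collected first: h may contain cancelling terms on which χ₁ and χ₂ differ.
coeffWhere-cong : ∀ χ₁ χ₂ → Respects≐ χ₁ → Respects≐ χ₂ → ∀ h →
                  (∀ β → χ₁ β ≢ χ₂ β → coeff h β ≡ 0ℚ) → coeffWhere h χ₁ ≡ coeffWhere h χ₂
coeffWhere-cong χ₁ χ₂ resp₁ resp₂ h = go (length h) h ≤-refl
  where
  same-if : ∀ b₁ b₂ x → (b₁ ≢ b₂ → x ≡ 0ℚ) → (if b₁ then x else 0ℚ) ≡ (if b₂ then x else 0ℚ)
  same-if true  true  x _ = refl
  same-if false false x _ = refl
  same-if true  false x z = z (λ ())
  same-if false true  x z = sym (z (λ ()))
  go : ∀ fuel h → length h ≤ fuel → (∀ β → χ₁ β ≢ χ₂ β → coeff h β ≡ 0ℚ) → coeffWhere h χ₁ ≡ coeffWhere h χ₂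
  go fuel       []             _          _    = refl
  go (suc fuel) h@((c , γ) ∷ t) (s≤s len) vanish = begin
    coeffWhere h χ₁
      ≡⟨ coeffWhere-dropExp χ₁ resp₁ γ h ⟩
    (if χ₁ γ then coeff h γ else 0ℚ) +ℚ coeffWhere (dropExp γ h) χ₁
      ≡⟨ cong₂ _+ℚ_ (same-if (χ₁ γ) (χ₂ γ) (coeff h γ) (vanish γ)) (go fuel (dropExp γ h) len′ vanish′) ⟩
    (if χ₂ γ then coeff h γ else 0ℚ) +ℚ coeffWhere (dropExp γ h) χ₂
      ≡⟨ sym (coeffWhere-dropExp χ₂ resp₂ γ h) ⟩
    coeffWhere h χ₂ ∎
    where
    open ≡-Reasoning
    len′ : length (dropExp γ h) ≤ fuel
    len′ rewrite ≐⇒sameExp γ γ ≐-refl = ≤-trans (length-dropExp γ t) len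
    vanish′ : ∀ β → χ₁ β ≢ χ₂ β → coeff (dropExp γ h) β ≡ 0ℚ
    vanish′ β ne with sameExp γ β in γβ
    ... | true  = coeff-dropExp-≐ γ h β (sameExp⇒≐ γ β γβ)
    ... | false = trans (coeff-dropExp-≢ γ h β (λ e → true≢false (trans (sym (≐⇒sameExp γ β e)) γβ))) (vanish β ne)
      where
      true≢false : true ≢ false
      true≢false ()

coeff-rPoly : ∀ m n h δ → RDefPoly m n h → RDefComp m n δ → coeff (rPoly m n h) δ ≡ coeff h (rExp m n δ)
coeff-rPoly m n h δ h-box δ-box = begin
  coeff (rPoly m n h) δ      ≡⟨ coeff-rPoly-coeffWhere m n h δ ⟩
  coeffWhere h χ₁            ≡⟨ coeffWhere-cong χ₁ χ₂ resp₁ resp₂ h vanish ⟩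
  coeffWhere h χ₂            ≡⟨ sym (coeff-coeffWhere h (rExp m n δ)) ⟩
  coeff h (rExp m n δ)       ∎
  where
  open ≡-Reasoning
  χ₁ χ₂ : Exp → Bool
  χ₁ β = sameExp (rExp m n β) δ
  χ₂ β = sameExp β (rExp m n δ)
  resp₁ : Respects≐ χ₁
  resp₁ a b e = sameExp-cong _ _ _ _ (≐-trans (rExp-cong m n (≐-sym e))) (≐-trans (rExp-cong m n e))
  resp₂ : Respects≐ χ₂
  resp₂ a b e = sameExp-cong _ _ _ _ (≐-trans (≐-sym e)) (≐-trans e)
  vanish : ∀ β → χ₁ β ≢ χ₂ β → coeff h β ≡ 0ℚ
  vanish β ne with coeff h β ℚ.≟ 0ℚ
  ... | yes z  = z
  ... | no nz = ⊥-elim (ne (sameExp-rExp m n β δ (h-box β nz) δ-box))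

coeff-rPoly-outside : ∀ m n h δ → ¬ RDefComp m n δ → coeff (rPoly m n h) δ ≡ 0ℚ
coeff-rPoly-outside m n []            δ δ∉ = refl
coeff-rPoly-outside m n ((c , β) ∷ h) δ δ∉ with sameExp (rExp m n β) δ in e
... | true  = ⊥-elim (δ∉ (box-cong {m} {n} (sameExp⇒≐ (rExp m n β) δ e) (rExp-box m n β)))
... | false = coeff-rPoly-outside m n h δ δ∉

coeff-box-vanishes : ∀ {m n} h P q → RDefPoly m n h → m < at P q → coeff h P ≡ 0ℚ
coeff-box-vanishes h P q h-box m<Pq with coeff h P ℚ.≟ 0ℚ
... | yes z  = z
... | no nz = ⊥-elim (<-irrefl refl (<-≤-trans m<Pq (proj₂ (h-box P nz) q)))

coeff-rPoly-vanishes : ∀ m n h P q → m < at P q → coeff (rPoly m n h) P ≡ 0ℚ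
coeff-rPoly-vanishes m n h P q m<Pq =
  coeff-rPoly-outside m n h P (λ P-box → <-irrefl refl (<-≤-trans m<Pq (proj₂ P-box q)))

rExp-≐ : ∀ m n P Q → (∀ p → p < n → at Q (mirror n p) ≡ m ∸ at P p) → (∀ q → n ≤ q → at Q q ≡ 0) →
         rExp m n P ≐ Q
rExp-≐ m n P Q inside outside = ≐-inside
  (λ q q<n → trans (at-rExp-< m n P q q<n)
               (trans (sym (inside (mirror n q) (mirror-< n q q<n))) (cong (at Q) (mirror-involutive n q q<n))))
  (λ q n≤q → trans (at-rExp-≥ m n P q n≤q) (sym (outside q n≤q)))

-- β agrees with r_{m,n}(δ), except that the mirrors of u and w carry m + 1 − δ_u and m + 1 − δ_w.
record Mirrored (m n u w : ℕ) (δ β : Exp) : Set where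
  field
    at-u     : at β (mirror n u) ≡ suc m ∸ at δ u
    at-w     : at β (mirror n w) ≡ suc m ∸ at δ w
    at-other : ∀ p → p < n → p ≢ u → p ≢ w → at β (mirror n p) ≡ m ∸ at δ p
    β-supp   : ∀ q → n ≤ q → at β q ≡ 0
    δ-supp   : ∀ q → n ≤ q → at δ q ≡ 0
    δ-other  : ∀ p → p < n → p ≢ u → p ≢ w → at δ p ≤ m
    δu≤      : at δ u ≤ suc m
    δw≤      : at δ w ≤ suc m

-- Both sides are the coefficient of h at r_{m,n}(δ − e_u) = β − e_{mirror w}, or both vanish.
mulX-rPoly : ∀ {m n u w δ β} h → RDefPoly m n h → u < n → w < n → u ≢ w → Mirrored m n u w δ β →
             mulX u (coeff (rPoly m n h)) δ ≡ mulX (mirror n w) (coeff h) β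
mulX-rPoly {m} {n} {u} {w} {δ} {β} h h-box u<n w<n u≢w mir = by-δu (at δ u) refl
  where
  open Mirrored mir
  u′ = mirror n u
  w′ = mirror n w
  u′≢w′ : u′ ≢ w′
  u′≢w′ = u≢w ∘ mirror-injective n u w u<n w<n

  lhs-zero-rhs : at δ u ≡ 0 → ∀ x → at β w′ ≡ x → mulX w′ (coeff h) β ≡ 0ℚ
  lhs-zero-rhs δu≡0 zero    βw′≡0 = mulX-zero w′ (coeff h) β βw′≡0
  lhs-zero-rhs δu≡0 (suc c) βw′≡c = trans (mulX-suc w′ (coeff h) β c βw′≡c)
    (coeff-box-vanishes h (update w′ c β) u′ h-box
      (subst (m <_) (sym (trans (at-update-≢ w′ c β u′ u′≢w′) (trans at-u (cong (suc m ∸_) δu≡0)))) ≤-refl))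

  δw-bounded : ∀ a → at δ u ≡ suc a → at δ w ≤ m → mulX u (coeff (rPoly m n h)) δ ≡ mulX w′ (coeff h) β
  δw-bounded a δu≡ δw≤m = begin
    mulX u (coeff (rPoly m n h)) δ ≡⟨ mulX-suc u _ δ a δu≡ ⟩
    coeff (rPoly m n h) P          ≡⟨ coeff-rPoly m n h P h-box P-box ⟩
    coeff h (rExp m n P)           ≡⟨ coeff-cong h rP≐Q ⟩
    coeff h Q                      ≡⟨ sym (mulX-suc w′ (coeff h) β (m ∸ at δ w) (trans at-w (+-∸-assoc 1 δw≤m))) ⟩
    mulX w′ (coeff h) β            ∎
    where
    open ≡-Reasoning
    P = update u a δ
    Q = update w′ (m ∸ at δ w) β
    Pw≡δw : at P w ≡ at δ w
    Pw≡δw = at-update-≢ u a δ w (u≢w ∘ sym)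
    P-box : RDefComp m n P
    P-box = (λ q n≤q → trans (at-update-≢ u a δ q (≥-≢ u<n n≤q)) (δ-supp q n≤q)) , bound
      where
      bound : ∀ q → at P q ≤ m
      bound q with q ≟ u | q ≟ w | q <? n
      ... | yes refl | _        | _       = subst (_≤ m) (sym (at-update-≡ u a δ)) (≤-pred (subst (_≤ suc m) δu≡ δu≤))
      ... | no _     | yes refl | _       = subst (_≤ m) (sym Pw≡δw) δw≤m
      ... | no q≢u   | no q≢w   | yes q<n = subst (_≤ m) (sym (at-update-≢ u a δ q q≢u)) (δ-other q q<n q≢u q≢w)
      ... | no q≢u   | no q≢w   | no q≮n  =
        subst (_≤ m) (sym (trans (at-update-≢ u a δ q q≢u) (δ-supp q (≮⇒≥ q≮n)))) z≤n
    rP≐Q : rExp m n P ≐ Q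
    rP≐Q = rExp-≐ m n P Q inside
      (λ q n≤q → trans (at-update-≢ w′ _ β q (≥-≢ (mirror-< n w w<n) n≤q)) (β-supp q n≤q))
      where
      inside : ∀ p → p < n → at Q (mirror n p) ≡ m ∸ at P p
      inside p p<n with p ≟ w | p ≟ u
      ... | yes refl | _        = trans (at-update-≡ w′ _ β) (cong (m ∸_) (sym Pw≡δw))
      ... | no p≢w   | yes refl = trans (at-update-≢ w′ _ β u′ u′≢w′)
                                   (trans at-u (trans (cong (suc m ∸_) δu≡) (cong (m ∸_) (sym (at-update-≡ u a δ)))))
      ... | no p≢w   | no p≢u   = trans (at-update-≢ w′ _ β (mirror n p) (p≢w ∘ mirror-injective n p w p<n w<n))
                                   (trans (at-other p p<n p≢u p≢w) (cong (m ∸_) (sym (at-update-≢ u a δ p p≢u))))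

  δw-maximal : ∀ a → at δ u ≡ suc a → ¬ at δ w ≤ m → mulX u (coeff (rPoly m n h)) δ ≡ mulX w′ (coeff h) β
  δw-maximal a δu≡ δw≰m = trans (mulX-suc u _ δ a δu≡)
    (trans (coeff-rPoly-vanishes m n h (update u a δ) w (subst (m <_) (sym (at-update-≢ u a δ w (u≢w ∘ sym))) (≰⇒> δw≰m)))
           (sym (mulX-zero w′ (coeff h) β (trans at-w (trans (cong (suc m ∸_) δw≡) (n∸n≡0 (suc m)))))))
    where
    δw≡ : at δ w ≡ suc m
    δw≡ = ≤-antisym δw≤ (≰⇒> δw≰m)

  by-δu : ∀ x → at δ u ≡ x → mulX u (coeff (rPoly m n h)) δ ≡ mulX w′ (coeff h) β
  by-δu zero    δu≡0 = trans (mulX-zero u _ δ δu≡0) (sym (lhs-zero-rhs δu≡0 (at β w′) refl))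
  by-δu (suc a) δu≡ with at δ w ≤? m
  ... | yes δw≤m = δw-bounded a δu≡ δw≤m
  ... | no δw≰m  = δw-maximal a δu≡ δw≰m

-- r_{m,n} intertwines π_{k+1} with π_{n−k−1}

module Reversal (m n k : ℕ) (sk<n : suc k < n) where

  k<n : k < n
  k<n = <⇒≤ sk<n

  k′ : ℕ
  k′ = mirror n (suc k)

  suc-k′ : suc k′ ≡ mirror n k
  suc-k′ = suc-mirror n (suc k) sk<n

  k′<n : k′ < n
  k′<n = mirror-< n (suc k) sk<n

  sk′<n : suc k′ < n
  sk′<n = subst (_< n) (sym suc-k′) (mirror-< n k k<n)

  mirror-k′ : mirror n k′ ≡ suc k
  mirror-k′ = mirror-involutive n (suc k) sk<n

  mirror-sk′ : mirror n (suc k′) ≡ k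
  mirror-sk′ = trans (cong (mirror n) suc-k′) (mirror-involutive n k k<n)

  mirror-≢-k : ∀ p → p < n → p ≢ suc k′ → mirror n p ≢ k
  mirror-≢-k p p<n p≢ e = p≢ (trans (sym (mirror-involutive n p p<n)) (trans (cong (mirror n) e) (sym suc-k′)))

  mirror-≢-suc-k : ∀ p → p < n → p ≢ k′ → mirror n p ≢ suc k
  mirror-≢-suc-k p p<n p≢ e = p≢ (trans (sym (mirror-involutive n p p<n)) (cong (mirror n) e))

  -- δ lies in the box except that its entries at k′ and k′ + 1 may reach m + 1.
  NearBox : Exp → Set
  NearBox δ = RDefComp m n (update₂ k′ 0 0 δ) × at δ k′ ≤ suc m × at δ (suc k′) ≤ suc m

  nearBox? : ∀ δ → Dec (NearBox δ)
  nearBox? δ with box? m n (update₂ k′ 0 0 δ) | at δ k′ ≤? suc m | at δ (suc k′) ≤? suc m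
  ... | yes a | yes b | yes c = yes (a , b , c)
  ... | no ¬a | _     | _     = no (¬a ∘ proj₁)
  ... | yes _ | no ¬b | _     = no (¬b ∘ proj₁ ∘ proj₂)
  ... | yes _ | yes _ | no ¬c = no (¬c ∘ proj₂ ∘ proj₂)

  nearBox-intro : ∀ δ P → (∀ p → p ≢ k′ → p ≢ suc k′ → at P p ≡ at δ p) → RDefComp m n P →
                  at δ k′ ≤ suc m → at δ (suc k′) ≤ suc m → NearBox δ
  nearBox-intro δ P agree (supp , bound) δk′≤ δsk′≤ =
    box-by-cases₂ (update₂ k′ 0 0 δ) P sk′<n
      (subst (_≤ m) (sym (at-update₂-k k′ 0 0 δ)) z≤n)
      (subst (_≤ m) (sym (at-update₂-suc k′ 0 0 δ)) z≤n)
      (λ p p≢ p≢s → trans (at-update₂-≢ k′ 0 0 δ p p≢ p≢s) (sym (agree p p≢ p≢s)))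
      (supp , bound) ,
    δk′≤ , δsk′≤

  module Unreversed (δ : Exp) (near : NearBox δ) where
    β : Exp
    β = update₂ k (suc m ∸ at δ (suc k′)) (suc m ∸ at δ k′) (rExp m n δ)

    at-k : at β k ≡ suc m ∸ at δ (suc k′)
    at-k = at-update₂-k k _ _ _

    at-sk : at β (suc k) ≡ suc m ∸ at δ k′
    at-sk = at-update₂-suc k _ _ _

    δ-supp : ∀ q → n ≤ q → at δ q ≡ 0
    δ-supp q n≤q = trans (sym (at-update₂-≢ k′ 0 0 δ q (≥-≢ k′<n n≤q) (≥-≢ sk′<n n≤q))) (proj₁ (proj₁ near) q n≤q)

    δ-other : ∀ p → p < n → p ≢ k′ → p ≢ suc k′ → at δ p ≤ m
    δ-other p _ p≢ p≢s = subst (_≤ m) (at-update₂-≢ k′ 0 0 δ p p≢ p≢s) (proj₂ (proj₁ near) p)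

    at-other : ∀ p → p < n → p ≢ k′ → p ≢ suc k′ → at β (mirror n p) ≡ m ∸ at δ p
    at-other p p<n p≢ p≢s =
      trans (at-update₂-≢ k _ _ _ (mirror n p) (mirror-≢-k p p<n p≢s) (mirror-≢-suc-k p p<n p≢))
            (trans (at-rExp-< m n δ (mirror n p) (mirror-< n p p<n)) (cong (λ q → m ∸ at δ q) (mirror-involutive n p p<n)))

    β-supp : ∀ q → n ≤ q → at β q ≡ 0
    β-supp q n≤q = trans (at-update₂-≢ k _ _ _ q (≥-≢ k<n n≤q) (≥-≢ sk<n n≤q)) (at-rExp-≥ m n δ q n≤q)

    mirrored : Mirrored m n k′ (suc k′) δ β
    mirrored = record
      { at-u = trans (cong (at β) mirror-k′) at-sk ; at-w = trans (cong (at β) mirror-sk′) at-k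
      ; at-other = at-other ; β-supp = β-supp ; δ-supp = δ-supp ; δ-other = δ-other
      ; δu≤ = proj₁ (proj₂ near) ; δw≤ = proj₂ (proj₂ near) }

    mirrored-flipped : Mirrored m n (suc k′) k′ δ β
    mirrored-flipped = record
      { at-u = trans (cong (at β) mirror-sk′) at-k ; at-w = trans (cong (at β) mirror-k′) at-sk
      ; at-other = λ p p<n p≢s p≢ → at-other p p<n p≢ p≢s ; β-supp = β-supp ; δ-supp = δ-supp
      ; δ-other = λ p p<n p≢s p≢ → δ-other p p<n p≢ p≢s
      ; δu≤ = proj₂ (proj₂ near) ; δw≤ = proj₁ (proj₂ near) }

    mirrored-swapped : Mirrored m n k′ (suc k′) (swapE k′ δ) (swapE k β)
    mirrored-swapped = record
      { at-u = trans (cong (at (swapE k β)) mirror-k′)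
                 (trans (at-swapE-suc k β) (trans at-k (cong (suc m ∸_) (sym (at-swapE-k k′ δ)))))
      ; at-w = trans (cong (at (swapE k β)) mirror-sk′)
                 (trans (at-swapE-k k β) (trans at-sk (cong (suc m ∸_) (sym (at-swapE-suc k′ δ)))))
      ; at-other = λ p p<n p≢ p≢s →
          trans (at-swapE-≢ k β (mirror n p) (mirror-≢-k p p<n p≢s) (mirror-≢-suc-k p p<n p≢))
                (trans (at-other p p<n p≢ p≢s) (cong (m ∸_) (sym (at-swapE-≢ k′ δ p p≢ p≢s))))
      ; β-supp = λ q n≤q → trans (at-swapE-≢ k β q (≥-≢ k<n n≤q) (≥-≢ sk<n n≤q)) (β-supp q n≤q)
      ; δ-supp = λ q n≤q → trans (at-swapE-≢ k′ δ q (≥-≢ k′<n n≤q) (≥-≢ sk′<n n≤q)) (δ-supp q n≤q)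
      ; δ-other = λ p p<n p≢ p≢s → subst (_≤ m) (sym (at-swapE-≢ k′ δ p p≢ p≢s)) (δ-other p p<n p≢ p≢s)
      ; δu≤ = subst (_≤ suc m) (sym (at-swapE-k k′ δ)) (proj₂ (proj₂ near))
      ; δw≤ = subst (_≤ suc m) (sym (at-swapE-suc k′ δ)) (proj₁ (proj₂ near)) }

  mulX-rPoly-far : ∀ h u D δ → ¬ NearBox δ →
                   (∀ a → at D u ≡ suc a → RDefComp m n (update u a D) → NearBox δ) →
                   mulX u (coeff (rPoly m n h)) D ≡ 0ℚ
  mulX-rPoly-far h u D δ far near-of with at D u
  ... | zero  = refl
  ... | suc a = coeff-rPoly-outside m n h (update u a D) (far ∘ near-of a refl)

  near-of-k′ : ∀ δ a → at δ k′ ≡ suc a → RDefComp m n (update k′ a δ) → NearBox δ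
  near-of-k′ δ a e P-box@(_ , bound) =
    nearBox-intro δ (update k′ a δ) (λ p p≢ _ → at-update-≢ k′ a δ p p≢) P-box
    (subst (_≤ suc m) (sym e) (s≤s (subst (_≤ m) (at-update-≡ k′ a δ) (bound k′))))
    (m≤n⇒m≤1+n (subst (_≤ m) (at-update-≢ k′ a δ (suc k′) 1+n≢n) (bound (suc k′))))

  near-of-sk′ : ∀ δ a → at δ (suc k′) ≡ suc a → RDefComp m n (update (suc k′) a δ) → NearBox δ
  near-of-sk′ δ a e P-box@(_ , bound) =
    nearBox-intro δ (update (suc k′) a δ) (λ p _ p≢s → at-update-≢ (suc k′) a δ p p≢s) P-box
    (m≤n⇒m≤1+n (subst (_≤ m) (at-update-≢ (suc k′) a δ k′ (≢-sym 1+n≢n)) (bound k′)))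
    (subst (_≤ suc m) (sym e) (s≤s (subst (_≤ m) (at-update-≡ (suc k′) a δ) (bound (suc k′)))))

  near-of-swapped : ∀ δ a → at (swapE k′ δ) k′ ≡ suc a → RDefComp m n (update k′ a (swapE k′ δ)) → NearBox δ
  near-of-swapped δ a e P-box@(_ , bound) = nearBox-intro δ P
    (λ p p≢ p≢s → trans (at-update-≢ k′ a _ p p≢) (at-swapE-≢ k′ δ p p≢ p≢s)) P-box
    (m≤n⇒m≤1+n (subst (_≤ m) (trans (at-update-≢ k′ a _ (suc k′) 1+n≢n) (at-swapE-suc k′ δ)) (bound (suc k′))))
    (subst (_≤ suc m) (trans (sym e) (at-swapE-k k′ δ)) (s≤s (subst (_≤ m) (at-update-≡ k′ a _) (bound k′))))
    where P = update k′ a (swapE k′ δ)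

  rPoly-π : ∀ g f → RDefPoly m n g → RDefPoly m n f → PiCoeffs k g f →
            PiCoeffs k′ (rPoly m n g) (rPoly m n f)
  rPoly-π g f g-box f-box pc δ with nearBox? δ
  ... | yes near = begin
    mulX k′ F′ δ -ℚ mulX (suc k′) F′ δ
      ≡⟨ cong₂ _-ℚ_ (mulX-rPoly f f-box k′<n sk′<n (≢-sym 1+n≢n) mirrored)
                    (mulX-rPoly f f-box sk′<n k′<n 1+n≢n mirrored-flipped) ⟩
    mulX (mirror n (suc k′)) (coeff f) β -ℚ mulX (mirror n k′) (coeff f) β
      ≡⟨ cong₂ (λ i j → mulX i (coeff f) β -ℚ mulX j (coeff f) β) mirror-sk′ mirror-k′ ⟩
    mulX k (coeff f) β -ℚ mulX (suc k) (coeff f) β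
      ≡⟨ pc β ⟩
    mulX k (coeff g) β -ℚ mulX k (coeff g) (swapE k β)
      ≡⟨ sym (cong₂ (λ i j → mulX i (coeff g) β -ℚ mulX j (coeff g) (swapE k β)) mirror-sk′ mirror-sk′) ⟩
    mulX (mirror n (suc k′)) (coeff g) β -ℚ mulX (mirror n (suc k′)) (coeff g) (swapE k β)
      ≡⟨ sym (cong₂ _-ℚ_ (mulX-rPoly g g-box k′<n sk′<n (≢-sym 1+n≢n) mirrored)
                         (mulX-rPoly g g-box k′<n sk′<n (≢-sym 1+n≢n) mirrored-swapped)) ⟩
    mulX k′ G′ δ -ℚ mulX k′ G′ (swapE k′ δ) ∎
    where
    open ≡-Reasoning
    open Unreversed δ near
    F′ = coeff (rPoly m n f)
    G′ = coeff (rPoly m n g)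
  ... | no far = trans
    (cong₂ _-ℚ_ (mulX-rPoly-far f k′ δ δ far (near-of-k′ δ)) (mulX-rPoly-far f (suc k′) δ δ far (near-of-sk′ δ)))
    (sym (cong₂ _-ℚ_ (mulX-rPoly-far g k′ δ δ far (near-of-k′ δ))
                     (mulX-rPoly-far g k′ (swapE k′ δ) δ far (near-of-swapped δ))))

  mirror-≢-k′ : ∀ p → p < n → p ≢ suc k → mirror n p ≢ k′
  mirror-≢-k′ p p<n p≢ e = p≢ (mirror-injective n p (suc k) p<n sk<n e)

  mirror-≢-suc-k′ : ∀ p → p < n → p ≢ k → mirror n p ≢ suc k′
  mirror-≢-suc-k′ p p<n p≢ e = p≢ (mirror-injective n p k p<n k<n (trans e suc-k′))

  rExp-swapE : ∀ α → rExp m n (swapE k α) ≐ swapE k′ (rExp m n α)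
  rExp-swapE α = rExp-≐ m n (swapE k α) (swapE k′ rα) inside outside
    where
    rα = rExp m n α
    at-rα : ∀ p → p < n → at rα (mirror n p) ≡ m ∸ at α p
    at-rα p p<n = trans (at-rExp-< m n α _ (mirror-< n p p<n)) (cong (λ q → m ∸ at α q) (mirror-involutive n p p<n))
    inside : ∀ p → p < n → at (swapE k′ rα) (mirror n p) ≡ m ∸ at (swapE k α) p
    inside p p<n with p ≟ k | p ≟ suc k
    ... | yes refl | _ = begin
      at (swapE k′ rα) (mirror n k)  ≡⟨ cong (at (swapE k′ rα)) (sym suc-k′) ⟩
      at (swapE k′ rα) (suc k′)      ≡⟨ at-swapE-suc k′ rα ⟩
      at rα (mirror n (suc k))       ≡⟨ at-rα (suc k) sk<n ⟩
      m ∸ at α (suc k)               ≡⟨ cong (m ∸_) (sym (at-swapE-k k α)) ⟩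
      m ∸ at (swapE k α) k           ∎
      where open ≡-Reasoning
    ... | no _ | yes refl = begin
      at (swapE k′ rα) k′            ≡⟨ at-swapE-k k′ rα ⟩
      at rα (suc k′)                 ≡⟨ cong (at rα) suc-k′ ⟩
      at rα (mirror n k)             ≡⟨ at-rα k k<n ⟩
      m ∸ at α k                     ≡⟨ cong (m ∸_) (sym (at-swapE-suc k α)) ⟩
      m ∸ at (swapE k α) (suc k)     ∎
      where open ≡-Reasoning
    ... | no p≢k | no p≢sk =
      trans (at-swapE-≢ k′ rα (mirror n p) (mirror-≢-k′ p p<n p≢sk) (mirror-≢-suc-k′ p p<n p≢k))
            (trans (at-rα p p<n) (cong (m ∸_) (sym (at-swapE-≢ k α p p≢k p≢sk))))
    outside : ∀ q → n ≤ q → at (swapE k′ rα) q ≡ 0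
    outside q n≤q = trans (at-swapE-≢ k′ rα q (≥-≢ k′<n n≤q) (≥-≢ sk′<n n≤q)) (at-rExp-≥ m n α q n≤q)

  rExp-ascent : ∀ α → RDefComp m n α → at α k < at α (suc k) → at (rExp m n α) k′ < at (rExp m n α) (suc k′)
  rExp-ascent α (_ , bound) A<B = subst₂ _<_
    (sym (trans (at-rExp-< m n α k′ k′<n) (cong (λ q → m ∸ at α q) mirror-k′)))
    (sym (trans (at-rExp-< m n α (suc k′) sk′<n) (cong (λ q → m ∸ at α q) mirror-sk′)))
    (∸-monoʳ-< A<B (bound (suc k)))

Key-cong : ∀ {α α′ f} → α ≐ α′ → Key α f → Key α′ f
Key-cong e (key-part part f≈) =
  key-part (λ p → subst₂ _≤_ (at-≡ e (suc p)) (at-≡ e p) (part p))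
           (λ β → trans (f≈ β) (coeff-mono-cong e β))
Key-cong e (key-step k A<B key-g pi) =
  key-step k (subst₂ _<_ (at-≡ e k) (at-≡ e (suc k)) A<B) (Key-cong (swapE-cong k e) key-g) pi

rExp-partition : ∀ m n α → IsPartition α → IsPartition (rExp m n α)
rExp-partition m n α part p with suc p <? n
... | yes sp<n = subst₂ _≤_ (sym (at-rExp-< m n α (suc p) sp<n)) (sym (at-rExp-< m n α p (<⇒≤ sp<n)))
  (∸-monoʳ-≤ m (subst (λ q → at α q ≤ at α (mirror n (suc p))) (suc-mirror n (suc p) sp<n) (part (mirror n (suc p)))))
... | no sp≮n = subst (_≤ at (rExp m n α) p) (sym (at-rExp-≥ m n α (suc p) (≮⇒≥ sp≮n))) z≤n

rPoly-cong : ∀ m n f g → RDefPoly m n f → RDefPoly m n g → f ≈ₚ g → rPoly m n f ≈ₚ rPoly m n g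
rPoly-cong m n f g f-box g-box f≈g δ with box? m n δ
... | yes δ-box = trans (coeff-rPoly m n f δ f-box δ-box)
                   (trans (f≈g (rExp m n δ)) (sym (coeff-rPoly m n g δ g-box δ-box)))
... | no δ∉ = trans (coeff-rPoly-outside m n f δ δ∉) (sym (coeff-rPoly-outside m n g δ δ∉))

key-rExp : ∀ {m n α f} → RDefComp m n α → Key α f → Key (rExp m n α) (rPoly m n f)
key-rExp {m} {n} α-box key-f@(key-part {α} {f} part f≈) =
  key-part (rExp-partition m n α part) (rPoly-cong m n f (mono α) (key-box α-box key-f) mono-box f≈)
  where
  mono-box : RDefPoly m n (mono α)
  mono-box β ne = box-cong (coeff-mono-nonzero α β ne) α-box
key-rExp {m} {n} α-box key-f@(key-step {α} {f} {g} k A<B key-g pi) =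
  key-step k′ (rExp-ascent α α-box A<B)
    (Key-cong (rExp-swapE α) (key-rExp sα-box key-g))
    (Equivalence.from (IsPi⇔PiCoeffs k′ (rPoly m n g) (rPoly m n f))
      (rPoly-π g f (key-box sα-box key-g) (key-box α-box key-f) (Equivalence.to (IsPi⇔PiCoeffs k g f) pi)))
  where
  sk<n = box-ascent k α α-box A<B
  open Reversal m n k sk<n
  sα-box = swapE-box k α sk<n α-box

proposition7p2 : (α : Exp) (m n : ℕ) → 0 < m → 0 < n → (f : Poly) → Key α f →
  (RDefComp m n α ⇔ RDefPoly m n f) × (RDefComp m n α → Key (rExp m n α) (rPoly m n f))
proposition7p2 α m n _ _ f key-f =
  mk⇔ (λ α-box → key-box α-box key-f) (box-of-key key-f) , λ α-box → key-rExp α-box key-f
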